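{- Let $S$ be a string of length $n$ ending with the unique end symbol $\$$, let $k\in[1,n]$, let $G_k(S)=(\mathcal{K},E)$ be its de Bruijn graph of order $k$ and $\mathsf{L}$ its BWT. Let $p_1=(x_{1,1},\dots,x_{1,w_1}),\dots,p_m=(x_{m,1},\dots,x_{m,w_m})$ be all longest paths in $G_k(S)$ such that $x_{i,j+1}$ is the only successor of $x_{i,j}$ and $x_{i,j}$ is the only predecessor of $x_{i,j+1}$ for all $1\le i\le m$ and $1\le j<w_i$, and let $\langle w_1-1,[i_1,j_1]\rangle,\dots,\langle w_m-1,[i_m,j_m]\rangle$ be the corresponding prefix intervals in $\mathsf{L}$ (where $[i_l,j_l]$ is the interval of rows of the sorted rotation matrix whose rotations have $x_{l,w_l}$ as a prefix). Then the length of the tunneled BWT $\mathsf{L}$ (and of $D_{\mathsf{out}}$, $D_{\mathsf{in}}$) obtained by tunneling these prefix intervals equals the number of edges of the edge-reduced de Bruijn graph $\tilde G_k(S)=(\mathcal{K},\tilde E)$, i.e. $|\mathsf{L}|=\sum_{(x,y)^m\in\tilde E} m$.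
   Context: $\Sigma$ is a finite totally ordered alphabet containing a symbol $\$$ smaller than all other symbols; $S$ is a string of length $n$ over $\Sigma$ whose last character is $\$$ and in which $\$$ occurs nowhere else. De Bruijn graph: $Z_k(S)=S[1..n]S[1..k]$, $\mathcal{K}=\{Z_k(S)[i..i+k-1]\mid i\in[1,n]\}$, and $G_k(S)=(\mathcal{K},E)$ is the directed multigraph with edge multiset $E=\{(x[1..k],x[2..k+1])^m\mid x\in\Sigma^{k+1}\text{ occurs exactly }m\ge1\text{ times in }Z_k(S)\}$. Edge-reduced graph: with $F=\{(x,y)^m\in E\mid y\text{ is the only successor of }x\text{ and }x\text{ the only predecessor of }y\}$, $\tilde G_k(S)=(\mathcal{K},\tilde E)$ where $\tilde E=(E\setminus F)\uplus\{(x,y)^1\mid(x,y)^m\in F\}$. BWT: $M$ is the matrix of the $n$ rotations of $S$ sorted lexicographically, $\mathsf{L}$ its last column; $\mathsf{C}[c]$ = number of characters in $\mathsf{L}$ smaller than $c$; $\mathsf{rank}_c(\mathsf{L},i)$ = occurrences of $c$ in $\mathsf{L}[1..i]$; $\mathsf{LF}[i]=\mathsf{C}[\mathsf{L}[i]]+\mathsf{rank}_{\mathsf{L}[i]}(\mathsf{L},i)$, with iterates $\mathsf{LF}^x$, $\mathsf{LF}^0=\mathrm{id}$, $\mathsf{LF}^{ -1}$ the inverse permutation. Prefix interval: $\langle w,[i,j]\rangle$, $w\ge0$, $[i,j]\subseteq[1,n]$, such that $\mathsf{L}[\mathsf{LF}^x[i]]=\dots=\mathsf{L}[\mathsf{LF}^x[j]]$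 for all $-1\le x<w$. Prefix intervals are disjoint if the sets $N_l=\{\mathsf{LF}^x[y]\mid i_l\le y\le j_l,\ 0\le x\le w_l\}$ are pairwise disjoint. Tunneling: given disjoint prefix intervals $\langle w_1,[i_1,j_1]\rangle,\dots,\langle w_r,[i_r,j_r]\rangle$ and bitvectors $D_{\mathsf{out}},D_{\mathsf{in}}$ of length $n$ initialized with ones: (1) for all $l$, set $D_{\mathsf{in}}[i_l+1]=\dots=D_{\mathsf{in}}[j_l]=0$ and $D_{\mathsf{out}}[\mathsf{LF}^{w_l}[i_l+1]]=\dots=D_{\mathsf{out}}[\mathsf{LF}^{w_l}[j_l]]=0$; (2) for all $l$, mark $\mathsf{L}[\mathsf{LF}^x[y]]$, $D_{\mathsf{out}}[\mathsf{LF}^x[y]]$ and $D_{\mathsf{in}}[\mathsf{LF}^{x+1}[y]]$ for all $i_l<y\le j_l$ and $0\le x<w_l$; (3) remove all marked entries from $\mathsf{L}$, $D_{\mathsf{out}}$ and $D_{\mathsf{in}}$. The result is the tunneled BWT. -}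

module Defs where

-- Conventions:
--  * alphabet Σ is modelled by ℕ with its usual order; the end symbol $ is 0
--  * strings are List ℕ; all string positions and BWT rows are 0-based
--    (paper index i corresponds to our i ∸ 1)

open import Data.Nat using (ℕ; zero; suc; _+_; _∸_; _<_; _≤_; NonZero; _%_; _≡ᵇ_; _<ᵇ_)
open import Data.Nat.Properties using (_≟_)
open import Data.Bool using (Bool; true; false; _∧_; _∨_; not; if_then_else_)
open import Data.List using (List; []; _∷_; _∷ʳ_; length; map; upTo; take; drop; filterᵇ; deduplicate; last)
open import Data.List.Properties using (≡-dec)
open import Data.Nat.ListAction using (sum)
open import Data.Bool.ListAction using (any)
open import Data.List.Relation.Unary.All using (All)
open import Data.List.Relation.Unary.Linked using (Linked)
open import Data.List.Relation.Unary.Unique.Propositional using (Unique)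
open import Data.Maybe using (Maybe; just; nothing)
open import Data.Product using (_×_; _,_; ∃-syntax)
open import Function using (_∘_)
open import Relation.Nullary using (¬_)
open import Relation.Nullary.Decidable using (⌊_⌋)
open import Relation.Binary.PropositionalEquality using (_≡_; _≢_)

-- character at (0-based) position i; 0 outside the string (never used there)
charAt : List ℕ → ℕ → ℕ
charAt []       _       = 0
charAt (c ∷ _)  zero    = c
charAt (_ ∷ cs) (suc i) = charAt cs i

countBelow : ℕ → (ℕ → Bool) → ℕ
countBelow zero    p = 0
countBelow (suc m) p = countBelow m p + (if p m then 1 else 0)

anyBelow : ℕ → (ℕ → Bool) → Bool
anyBelow zero    p = false
anyBelow (suc m) p = anyBelow m p ∨ p m

allBelow : ℕ → (ℕ → Bool) → Bool
allBelow zero    p = true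
allBelow (suc m) p = allBelow m p ∧ p m

-- least m' < m with p m' (m if none)
firstBelow : ℕ → (ℕ → Bool) → ℕ
firstBelow zero    p = zero
firstBelow (suc m) p = if p 0 then 0 else suc (firstBelow m (p ∘ suc))

-- greatest m' < m with p m' (0 if none)
lastBelow : ℕ → (ℕ → Bool) → ℕ
lastBelow zero    p = 0
lastBelow (suc m) p = if p m then m else lastBelow m p

iter : ℕ → (ℕ → ℕ) → ℕ → ℕ
iter zero    f y = y
iter (suc x) f y = f (iter x f y)

_==ₗ_ : List ℕ → List ℕ → Bool
xs ==ₗ ys = ⌊ ≡-dec _≟_ xs ys ⌋

lastNode : List (List ℕ) → List ℕ
lastNode p with last p
... | just x  = x
... | nothing = []

IsEndMarked : List ℕ → Set
IsEndMarked S = charAt S (length S ∸ 1) ≡ 0 × (∀ i → suc i < length S → charAt S i ≢ 0)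

module _ (S : List ℕ) {{_ : NonZero (length S)}} where

  Sc : ℕ → ℕ
  Sc i = charAt S (i % length S)

  -- the length-len substring of Z_k(S) (= S S[1..k]) starting at position i (i < n, len ≤ k+1)
  cyc : ℕ → ℕ → List ℕ
  cyc i len = map (λ t → Sc (i + t)) (upTo len)

  -- sorted rotation matrix: row r (0-based) is the rotation of S starting at sa r

  RotLt : ℕ → ℕ → Set
  RotLt i i' = ∃[ j ] (j < length S × (∀ t → t < j → Sc (i + t) ≡ Sc (i' + t)) × Sc (i + j) < Sc (i' + j))

  IsSortedRotations : (ℕ → ℕ) → Set
  IsSortedRotations sa =
    (∀ r → r < length S → sa r < length S) ×
    (∀ r r' → r < r' → r' < length S → RotLt (sa r) (sa r'))

  IsNode : ℕ → List ℕ → Set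
  IsNode k x = ∃[ i ] (i < length S × cyc i k ≡ x)

  Edge : ℕ → List ℕ → List ℕ → Set
  Edge k x y = ∃[ i ] (i < length S × take k (cyc i (suc k)) ≡ x × drop 1 (cyc i (suc k)) ≡ y)

  InF : ℕ → List ℕ → List ℕ → Set
  InF k x y = Edge k x y × (∀ y' → Edge k x y' → y' ≡ y) × (∀ x' → Edge k x' y → x' ≡ x)

  IsUnaryPath : ℕ → List (List ℕ) → Set
  IsUnaryPath k p = p ≢ [] × All (IsNode k) p × Unique p × Linked (InF k) p

  IsLongestUnaryPath : ℕ → List (List ℕ) → Set
  IsLongestUnaryPath k p =
    IsUnaryPath k p × (∀ z → ¬ IsUnaryPath k (z ∷ p)) × (∀ z → ¬ IsUnaryPath k (p ∷ʳ z))

  onlySuccᵇ : ℕ → List ℕ → List ℕ → Bool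
  onlySuccᵇ k x y = allBelow (length S) (λ i →
    not (take k (cyc i (suc k)) ==ₗ x) ∨ (drop 1 (cyc i (suc k)) ==ₗ y))

  onlyPredᵇ : ℕ → List ℕ → List ℕ → Bool
  onlyPredᵇ k x y = allBelow (length S) (λ i →
    not (drop 1 (cyc i (suc k)) ==ₗ y) ∨ (take k (cyc i (suc k)) ==ₗ x))

  inFᵇ : ℕ → List ℕ → Bool
  inFᵇ k z = onlySuccᵇ k (take k z) (drop 1 z) ∧ onlyPredᵇ k (take k z) (drop 1 z)

  -- multiplicity m of the edge given by the (k+1)-mer z: occurrences of z in Z_k(S)
  mult : ℕ → List ℕ → ℕ
  mult k z = countBelow (length S) (λ i → cyc i (suc k) ==ₗ z)

  -- the distinct (k+1)-mers of Z_k(S) (one per distinct edge of E)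
  edgeKmers : ℕ → List (List ℕ)
  edgeKmers k = deduplicate (≡-dec _≟_) (map (λ i → cyc i (suc k)) (upTo (length S)))

  reducedEdgeCount : ℕ → ℕ
  reducedEdgeCount k = sum (map (λ z → if inFᵇ k z then 1 else mult k z) (edgeKmers k))

  module _ (sa : ℕ → ℕ) where

    -- last column of the sorted rotation matrix
    L : ℕ → ℕ
    L r = Sc (sa r + (length S ∸ 1))

    Ccount : ℕ → ℕ
    Ccount c = countBelow (length S) (λ r → L r <ᵇ c)

    rank : ℕ → ℕ → ℕ
    rank c i = countBelow i (λ r → L r ≡ᵇ c)

    -- LF, 0-based: paper's LF[i] = C[L[i]] + rank_{L[i]}(L,i) with i = r + 1, minus 1
    LF : ℕ → ℕ
    LF r = Ccount (L r) + rank (L r) (suc r) ∸ 1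

    record PrefixInterval : Set where
      constructor ⟨_,[_,_]⟩
      field
        w : ℕ
        i : ℕ
        j : ℕ

    prefixInterval : ℕ → List (List ℕ) → PrefixInterval
    prefixInterval k p =
      ⟨ length p ∸ 1 ,[ firstBelow (length S) hasPrefix , lastBelow (length S) hasPrefix ]⟩
      where
        hasPrefix : ℕ → Bool
        hasPrefix r = cyc (sa r) k ==ₗ lastNode p

    -- tunneling (rows i+1..j are y = suc i + d with d < j ∸ i)

    -- step (2): entries marked in L and D_out
    markedOut : List PrefixInterval → ℕ → Bool
    markedOut ivs q = any (λ iv → let open PrefixInterval iv in
      anyBelow (j ∸ i) (λ d → anyBelow w (λ x → iter x LF (suc i + d) ≡ᵇ q))) ivs

    -- step (2): entries marked in D_in
    markedIn : List PrefixInterval → ℕ → Bool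
    markedIn ivs q = any (λ iv → let open PrefixInterval iv in
      anyBelow (j ∸ i) (λ d → anyBelow w (λ x → iter (suc x) LF (suc i + d) ≡ᵇ q))) ivs

    -- step (1): D_in and D_out after zeroing
    Din₁ : List PrefixInterval → ℕ → Bool
    Din₁ ivs q = not (any (λ iv → let open PrefixInterval iv in
      anyBelow (j ∸ i) (λ d → suc i + d ≡ᵇ q)) ivs)

    Dout₁ : List PrefixInterval → ℕ → Bool
    Dout₁ ivs q = not (any (λ iv → let open PrefixInterval iv in
      anyBelow (j ∸ i) (λ d → iter w LF (suc i + d) ≡ᵇ q)) ivs)

    tunneledL : List PrefixInterval → List ℕ
    tunneledL ivs = map L (filterᵇ (not ∘ markedOut ivs) (upTo (length S)))

    tunneledDout : List PrefixInterval → List Bool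
    tunneledDout ivs = map (Dout₁ ivs) (filterᵇ (not ∘ markedOut ivs) (upTo (length S)))

    tunneledDin : List PrefixInterval → List Bool
    tunneledDin ivs = map (Din₁ ivs) (filterᵇ (not ∘ markedIn ivs) (upTo (length S)))

module Submission where

-- Let n = |S|, `prev t = t − 1 (mod n)` and `pos` the inverse of the suffix array `sa`.
--  (1) LF = pos ∘ prev ∘ sa (`LF≡σ`): LF is increasing on rows with equal last character,
--      and along an edge (u , v) ∈ F it maps the block of rows prefixed by v onto the block
--      prefixed by u, first row onto first row.
--  (2) Row q is marked in L and D_out iff it is *redundant*: the edge entering its rotation
--      is in F and q is not the first row of its block.  "⇒" follows the LF-chain of a prefix
--      interval back along its path; "⇐" builds the longest unary path through the node of
--      q by walking along F-edges, which stops because the node ending in $ occurs once.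
--  (3) Grouped by entering edge, an F-edge of multiplicity m enters m − 1 redundant rows and
--      other edges none, so #redundant + |Ẽ| = n.  D_in is marked at the LF-images of the
--      rows marked in D_out, so its count agrees.

open import Data.Bool using (Bool; true; false; _∧_; _∨_; not; if_then_else_; T)
open import Data.Bool.Properties using (∧-identityʳ; ∧-zeroʳ)
open import Data.Bool.ListAction using (any)
open import Data.Empty using (⊥; ⊥-elim)
open import Data.List using (List; []; _∷_; _∷ʳ_; _++_; length; map; upTo; filterᵇ; applyUpTo; take; drop)
open import Data.List.Properties using (upTo-∷ʳ; map-upTo; map-applyUpTo; ∷-injective; ≡-dec; length-applyUpTo; length-map; map-cong-local)
open import Data.List.Membership.Propositional using (_∈_)
open import Data.List.Membership.Propositional.Properties using (∈-deduplicate⁻; ∈-deduplicate⁺; ∈-map⁻; ∈-map⁺; ∈-upTo⁻; ∈-upTo⁺)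
open import Data.List.Relation.Unary.All using (All) renaming (lookup to All-lookup; tabulate to All-tabulate)
open import Data.List.Relation.Unary.All.Properties using (applyUpTo⁺₁)
open import Data.List.Relation.Unary.AllPairs using ([]; _∷_)
open import Data.List.Relation.Unary.Any using (here; there)
open import Data.List.Relation.Unary.Linked using (Linked; []; [-]; _∷_)
open import Data.List.Relation.Unary.Unique.Propositional using (Unique)
import Data.List.Relation.Unary.Unique.DecPropositional.Properties as UniqueDec
open import Data.Nat using (ℕ; zero; suc; _+_; _∸_; _<_; _≤_; z≤n; s≤s; _≡ᵇ_; _<ᵇ_; NonZero; _%_; >-nonZero⁻¹)
open import Data.Nat.DivMod using (m%n<n; m%n%n≡m%n; %-distribˡ-+; [m+n]%n≡m%n; m<n⇒m%n≡m; m%n≤m)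
open import Data.Nat.ListAction using (sum)
open import Data.Nat.Properties
open import Algebra.Properties.CommutativeSemigroup +-commutativeSemigroup using (interchange; xy∙z≈xz∙y)
open import Data.Product using (_×_; _,_; ∃-syntax; proj₁; proj₂)
open import Data.Sum using (_⊎_; inj₁; inj₂)
open import Function using (_∘_)
open import Relation.Binary.Definitions using (tri<; tri≈; tri>)
open import Relation.Binary.PropositionalEquality
open import Relation.Nullary using (¬_; yes; no)
open import Defs

true≢false : true ≢ false
true≢false ()

≢true⇒≡false : ∀ {b} → b ≢ true → b ≡ false
≢true⇒≡false {false} _ = refl
≢true⇒≡false {true}  h = ⊥-elim (h refl)

∧-true⁻ : ∀ {a b} → a ∧ b ≡ true → a ≡ true × b ≡ true
∧-true⁻ {true} {true} _ = refl , refl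

∧-true⁺ : ∀ {a b} → a ≡ true → b ≡ true → a ∧ b ≡ true
∧-true⁺ refl refl = refl

∨-true⁻ : ∀ {a b} → a ∨ b ≡ true → a ≡ true ⊎ b ≡ true
∨-true⁻ {true}  _ = inj₁ refl
∨-true⁻ {false} e = inj₂ e

∨-trueˡ : ∀ {a b} → a ≡ true → a ∨ b ≡ true
∨-trueˡ refl = refl

∨-trueʳ : ∀ {a b} → b ≡ true → a ∨ b ≡ true
∨-trueʳ {true}  _ = refl
∨-trueʳ {false} e = e

not-true⁻ : ∀ {b} → not b ≡ true → b ≡ false
not-true⁻ {false} _ = refl

not-true⁺ : ∀ {b} → b ≡ false → not b ≡ true
not-true⁺ refl = refl

not-false⁻ : ∀ {b} → not b ≡ false → b ≡ true
not-false⁻ {true} _ = refl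

Bool-≡ : ∀ {a b} → (a ≡ true → b ≡ true) → (b ≡ true → a ≡ true) → a ≡ b
Bool-≡ {true}           f g = sym (f refl)
Bool-≡ {false} {true}  f g = g refl
Bool-≡ {false} {false} f g = refl

T⇒≡true : ∀ {b} → T b → b ≡ true
T⇒≡true {true} _ = refl

≡true⇒T : ∀ {b} → b ≡ true → T b
≡true⇒T refl = _

≡ᵇ-true⁻ : ∀ {m n} → (m ≡ᵇ n) ≡ true → m ≡ n
≡ᵇ-true⁻ {m} {n} e = ≡ᵇ⇒≡ m n (≡true⇒T e)

≡ᵇ-true⁺ : ∀ {m n} → m ≡ n → (m ≡ᵇ n) ≡ true
≡ᵇ-true⁺ {m} {n} e = T⇒≡true (≡⇒≡ᵇ m n e)

≡ᵇ-false⁺ : ∀ {m n} → m ≢ n → (m ≡ᵇ n) ≡ false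
≡ᵇ-false⁺ h = ≢true⇒≡false (h ∘ ≡ᵇ-true⁻)

<ᵇ-true⁻ : ∀ {m n} → (m <ᵇ n) ≡ true → m < n
<ᵇ-true⁻ {m} {n} e = <ᵇ⇒< m n (≡true⇒T e)

<ᵇ-true⁺ : ∀ {m n} → m < n → (m <ᵇ n) ≡ true
<ᵇ-true⁺ lt = T⇒≡true (<⇒<ᵇ lt)

<ᵇ-false⁺ : ∀ {m n} → ¬ m < n → (m <ᵇ n) ≡ false
<ᵇ-false⁺ h = ≢true⇒≡false (h ∘ <ᵇ-true⁻)

==ₗ-true⁻ : ∀ {xs ys : List ℕ} → (xs ==ₗ ys) ≡ true → xs ≡ ys
==ₗ-true⁻ {xs} {ys} e with ≡-dec _≟_ xs ys
... | yes eq = eq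

==ₗ-true⁺ : ∀ {xs ys : List ℕ} → xs ≡ ys → (xs ==ₗ ys) ≡ true
==ₗ-true⁺ {xs} {ys} e with ≡-dec _≟_ xs ys
... | yes _  = refl
... | no neq = ⊥-elim (neq e)

indicator : Bool → ℕ
indicator b = if b then 1 else 0

countBelow-cong : ∀ m {p q : ℕ → Bool} → (∀ i → i < m → p i ≡ q i) → countBelow m p ≡ countBelow m q
countBelow-cong zero    h = refl
countBelow-cong (suc m) {p} {q} h rewrite h m ≤-refl =
  cong (_+ indicator (q m)) (countBelow-cong m (λ i i<m → h i (m<n⇒m<1+n i<m)))

countBelow-none : ∀ m {p : ℕ → Bool} → (∀ i → i < m → p i ≡ false) → countBelow m p ≡ 0
countBelow-none zero    h = refl
countBelow-none (suc m) h rewrite h m ≤-refl | countBelow-none m (λ i i<m → h i (m<n⇒m<1+n i<m)) = refl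

countBelow-all : ∀ m {p : ℕ → Bool} → (∀ i → i < m → p i ≡ true) → countBelow m p ≡ m
countBelow-all zero    h = refl
countBelow-all (suc m) h rewrite h m ≤-refl | countBelow-all m (λ i i<m → h i (m<n⇒m<1+n i<m)) = +-comm m 1

indicator-split : ∀ a b → indicator a ≡ indicator (a ∧ b) + indicator (a ∧ not b)
indicator-split true  true  = refl
indicator-split true  false = refl
indicator-split false b     = refl

countBelow-split : ∀ m (p q : ℕ → Bool) →
  countBelow m p ≡ countBelow m (λ i → p i ∧ q i) + countBelow m (λ i → p i ∧ not (q i))
countBelow-split zero    p q = refl
countBelow-split (suc m) p q rewrite countBelow-split m p q | indicator-split (p m) (q m) =
  interchange (countBelow m (λ i → p i ∧ q i)) (countBelow m (λ i → p i ∧ not (q i)))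
              (indicator (p m ∧ q m)) (indicator (p m ∧ not (q m)))

countBelow-∨ : ∀ m (p q : ℕ → Bool) → (∀ i → i < m → p i ≡ true → q i ≡ false) →
  countBelow m (λ i → p i ∨ q i) ≡ countBelow m p + countBelow m q
countBelow-∨ zero    p q h = refl
countBelow-∨ (suc m) p q h rewrite countBelow-∨ m p q (λ i i<m → h i (m<n⇒m<1+n i<m)) =
  step (p m) (q m) (h m ≤-refl)
  where
  step : ∀ a b → (a ≡ true → b ≡ false) →
    countBelow m p + countBelow m q + indicator (a ∨ b) ≡ countBelow m p + indicator a + (countBelow m q + indicator b)
  step true  b disjoint rewrite disjoint refl = interchange (countBelow m p) (countBelow m q) 1 0
  step false b _ = interchange (countBelow m p) (countBelow m q) 0 (indicator b)

countBelow-<ᵇ : ∀ m a → a ≤ m → countBelow m (λ i → i <ᵇ a) ≡ a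
countBelow-<ᵇ zero    .zero z≤n = refl
countBelow-<ᵇ (suc m) a a≤ with m <? a
... | yes m<a rewrite <ᵇ-true⁺ m<a | countBelow-all m (λ i i<m → <ᵇ-true⁺ (<-trans i<m m<a)) =
  trans (+-comm m 1) (≤-antisym m<a a≤)
... | no m≮a rewrite <ᵇ-false⁺ m≮a = trans (+-identityʳ _) (countBelow-<ᵇ m a (≮⇒≥ m≮a))

countBelow-restrict : ∀ m r (p : ℕ → Bool) → r ≤ m → countBelow m (λ i → p i ∧ (i <ᵇ r)) ≡ countBelow r p
countBelow-restrict zero .zero p z≤n = refl
countBelow-restrict (suc m) r p r≤ with m <? r
... | no m≮r rewrite <ᵇ-false⁺ m≮r | ∧-zeroʳ (p m) = trans (+-identityʳ _) (countBelow-restrict m r p (≮⇒≥ m≮r))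
... | yes m<r with ≤-antisym m<r r≤
... | refl = countBelow-cong (suc m) (λ i i<sm → trans (cong (p i ∧_) (<ᵇ-true⁺ i<sm)) (∧-identityʳ (p i)))

countBelow-remove : ∀ m a (p : ℕ → Bool) → a < m →
  countBelow m p ≡ countBelow m (λ i → p i ∧ not (i ≡ᵇ a)) + indicator (p a)
countBelow-remove (suc m) a p a< with a <? m
... | no a≮m with ≤-antisym (≤-pred a<) (≮⇒≥ a≮m)
... | refl rewrite ≡ᵇ-true⁺ {m} refl | ∧-zeroʳ (p m) =
  cong (_+ indicator (p m)) (trans (countBelow-cong m others) (sym (+-identityʳ _)))
  where
  others : ∀ i → i < m → p i ≡ p i ∧ not (i ≡ᵇ m)
  others i i<m = sym (trans (cong (λ z → p i ∧ not z) (≡ᵇ-false⁺ (<⇒≢ i<m))) (∧-identityʳ (p i)))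
countBelow-remove (suc m) a p a< | yes a<m
  rewrite countBelow-remove m a p a<m | ≡ᵇ-false⁺ {m} {a} (λ e → <⇒≢ a<m (sym e)) | ∧-identityʳ (p m) =
  xy∙z≈xz∙y (countBelow m (λ i → p i ∧ not (i ≡ᵇ a))) (indicator (p a)) (indicator (p m))

countBelow-unique : ∀ m a (p : ℕ → Bool) → a < m → (∀ i → i < m → p i ≡ true → i ≡ a) → p a ≡ true →
  countBelow m p ≡ 1
countBelow-unique m a p a< only pa =
  trans (countBelow-remove m a p a<) (cong₂ _+_ (countBelow-none m elsewhere) (cong indicator pa))
  where
  elsewhere : ∀ i → i < m → p i ∧ not (i ≡ᵇ a) ≡ false
  elsewhere i i<m with p i in e
  ... | false = refl
  ... | true rewrite ≡ᵇ-true⁺ (only i i<m e) = refl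

countBelow-two : ∀ m a b (p : ℕ → Bool) → a < m → b < m → a ≢ b → p a ≡ true → p b ≡ true →
  2 ≤ countBelow m p
countBelow-two m a b p a< b< a≢b pa pb
  rewrite countBelow-remove m a p a< | pa
        | countBelow-remove m b (λ i → p i ∧ not (i ≡ᵇ a)) b< | pb | ≡ᵇ-false⁺ (λ e → a≢b (sym e)) =
  +-monoˡ-≤ 1 (m≤n+m 1 _)

countBelow-injection : ∀ a b (p : ℕ → Bool) (f : ℕ → ℕ) → (∀ i → i < a → f i < b) →
  (∀ i i' → i < a → i' < a → f i ≡ f i' → i ≡ i') → countBelow a (λ i → p (f i)) ≤ countBelow b p
countBelow-injection zero    b p f into inj = z≤n
countBelow-injection (suc a) b p f into inj rewrite countBelow-remove b (f a) p (into a ≤-refl) =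
  +-monoˡ-≤ (indicator (p (f a))) (≤-trans (≤-reflexive (countBelow-cong a avoids)) (countBelow-injection a b _ f into' inj'))
  where
  into' : ∀ i → i < a → f i < b
  into' i i<a = into i (m<n⇒m<1+n i<a)
  inj' : ∀ i i' → i < a → i' < a → f i ≡ f i' → i ≡ i'
  inj' i i' i< i'< = inj i i' (m<n⇒m<1+n i<) (m<n⇒m<1+n i'<)
  avoids : ∀ i → i < a → p (f i) ≡ p (f i) ∧ not (f i ≡ᵇ f a)
  avoids i i<a = sym (trans (cong (λ z → p (f i) ∧ not z)
                    (≡ᵇ-false⁺ (λ e → <⇒≢ i<a (inj i a (m<n⇒m<1+n i<a) ≤-refl e)))) (∧-identityʳ _))

anyBelow-true⁻ : ∀ m (p : ℕ → Bool) → anyBelow m p ≡ true → ∃[ i ] (i < m × p i ≡ true)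
anyBelow-true⁻ (suc m) p e with ∨-true⁻ {anyBelow m p} e
... | inj₂ pm = m , ≤-refl , pm
... | inj₁ e' with anyBelow-true⁻ m p e'
...   | i , i< , pi = i , m<n⇒m<1+n i< , pi

anyBelow-true⁺ : ∀ m (p : ℕ → Bool) i → i < m → p i ≡ true → anyBelow m p ≡ true
anyBelow-true⁺ (suc m) p i i< pi with i <? m
... | yes i<m = ∨-trueˡ (anyBelow-true⁺ m p i i<m pi)
... | no i≮m with ≤-antisym (≤-pred i<) (≮⇒≥ i≮m)
... | refl = ∨-trueʳ {anyBelow i p} pi

anyBelow-false⁻ : ∀ m (p : ℕ → Bool) → anyBelow m p ≡ false → ∀ i → i < m → p i ≡ false
anyBelow-false⁻ m p e i i< = ≢true⇒≡false (λ pi → true≢false (trans (sym (anyBelow-true⁺ m p i i< pi)) e))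

anyBelow-cong : ∀ m {p q : ℕ → Bool} → (∀ i → i < m → p i ≡ q i) → anyBelow m p ≡ anyBelow m q
anyBelow-cong zero    h = refl
anyBelow-cong (suc m) h = cong₂ _∨_ (anyBelow-cong m (λ i i< → h i (m<n⇒m<1+n i<))) (h m ≤-refl)

allBelow-true⁻ : ∀ m (p : ℕ → Bool) → allBelow m p ≡ true → ∀ i → i < m → p i ≡ true
allBelow-true⁻ (suc m) p e i i< with ∧-true⁻ {allBelow m p} e | i <? m
... | below , _  | yes i<m = allBelow-true⁻ m p below i i<m
... | _     , pm | no i≮m with ≤-antisym (≤-pred i<) (≮⇒≥ i≮m)
... | refl = pm

allBelow-true⁺ : ∀ m (p : ℕ → Bool) → (∀ i → i < m → p i ≡ true) → allBelow m p ≡ true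
allBelow-true⁺ zero    p h = refl
allBelow-true⁺ (suc m) p h = ∧-true⁺ (allBelow-true⁺ m p (λ i i< → h i (m<n⇒m<1+n i<))) (h m ≤-refl)

firstBelow-spec : ∀ m (p : ℕ → Bool) i → i < m → p i ≡ true → firstBelow m p ≤ i × p (firstBelow m p) ≡ true
firstBelow-spec (suc m) p i i< pi with p 0 in e
... | true = z≤n , e
... | false with i
...   | zero   = ⊥-elim (true≢false (trans (sym pi) e))
...   | suc i' with firstBelow-spec m (p ∘ suc) i' (≤-pred i<) pi
...     | le , pf = s≤s le , pf

firstBelow-minimal : ∀ m (p : ℕ → Bool) i → i < firstBelow m p → p i ≡ false
firstBelow-minimal (suc m) p i i< with p 0 in e
firstBelow-minimal (suc m) p i       ()  | true
firstBelow-minimal (suc m) p zero    i<  | false = e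
firstBelow-minimal (suc m) p (suc i) i<  | false = firstBelow-minimal m (p ∘ suc) i (≤-pred i<)

firstBelow-< : ∀ m (p : ℕ → Bool) i → i < m → p i ≡ true → firstBelow m p < m
firstBelow-< m p i i< pi = ≤-<-trans (proj₁ (firstBelow-spec m p i i< pi)) i<

firstBelow-witness : ∀ m (p : ℕ → Bool) → ∃[ i ] (i < m × p i ≡ true) → firstBelow m p < m × p (firstBelow m p) ≡ true
firstBelow-witness m p (i , i< , pi) = firstBelow-< m p i i< pi , proj₂ (firstBelow-spec m p i i< pi)

lastBelow-spec : ∀ m (p : ℕ → Bool) i → i < m → p i ≡ true → i ≤ lastBelow m p × p (lastBelow m p) ≡ true
lastBelow-spec (suc m) p i i< pi with p m in e
... | true = ≤-pred i< , e
... | false with i <? m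
...   | yes i<m = lastBelow-spec m p i i<m pi
...   | no i≮m = ⊥-elim (true≢false (trans (sym pi) (trans (cong p (≤-antisym (≤-pred i<) (≮⇒≥ i≮m))) e)))

lastBelow-none : ∀ m (p : ℕ → Bool) → (∀ i → i < m → p i ≡ false) → lastBelow m p ≡ 0
lastBelow-none zero    p h = refl
lastBelow-none (suc m) p h rewrite h m ≤-refl = lastBelow-none m p (λ i i< → h i (m<n⇒m<1+n i<))

lastBelow-≤ : ∀ m (p : ℕ → Bool) → lastBelow m p ≤ m
lastBelow-≤ zero    p = z≤n
lastBelow-≤ (suc m) p with p m
... | true  = n≤1+n m
... | false = m≤n⇒m≤1+n (lastBelow-≤ m p)

lastBelow-< : ∀ m (p : ℕ → Bool) → lastBelow (suc m) p < suc m
lastBelow-< m p with p m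
... | true  = ≤-refl
... | false = s≤s (lastBelow-≤ m p)

injection⇒surjection : ∀ m (f : ℕ → ℕ) → (∀ i → i < m → f i < m) → (∀ i i' → i < m → i' < m → f i ≡ f i' → i ≡ i') →
  ∀ c → c < m → ∃[ i ] (i < m × f i ≡ c)
injection⇒surjection m f into inj c c< with anyBelow m (λ i → f i ≡ᵇ c) in hit
... | true with anyBelow-true⁻ m _ hit
...   | i , i< , fi≡c = i , i< , ≡ᵇ-true⁻ fi≡c
injection⇒surjection m f into inj c c< | false = ⊥-elim (<-irrefl refl tooMany)
  where
  -- every image avoids c, yet only m − 1 indices below m avoid c
  avoidC : countBelow m (λ i → not (f i ≡ᵇ c)) ≡ m
  avoidC = countBelow-all m (λ i i< → not-true⁺ (anyBelow-false⁻ m _ hit i i<))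
  total : countBelow m (λ _ → true) ≡ countBelow m (λ i → not (i ≡ᵇ c)) + 1
  total = countBelow-remove m c (λ _ → true) c<
  tooMany : suc m ≤ m
  tooMany = ≤-trans (≤-reflexive (cong suc (sym avoidC)))
              (≤-trans (s≤s (countBelow-injection m m (λ y → not (y ≡ᵇ c)) f into inj))
                (≤-reflexive (trans (+-comm 1 _) (sym (trans (sym (countBelow-all m (λ _ _ → refl))) total)))))

countBelow-permute : ∀ m (f : ℕ → ℕ) (p : ℕ → Bool) → (∀ i → i < m → f i < m) →
  (∀ i i' → i < m → i' < m → f i ≡ f i' → i ≡ i') → countBelow m (λ i → p (f i)) ≡ countBelow m p
countBelow-permute m f p into inj =
  ≤-antisym (countBelow-injection m m p f into inj)
    (≤-trans (≤-reflexive (countBelow-cong m (λ c c< → cong p (sym (proj₂ (inverse c c<))))))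
      (countBelow-injection m m (λ i → p (f i)) g (λ c c< → proj₁ (inverse c c<))
        (λ c c' c< c'< e → trans (sym (proj₂ (inverse c c<))) (trans (cong f e) (proj₂ (inverse c' c'<))))))
  where
  g : ℕ → ℕ
  g c = firstBelow m (λ i → f i ≡ᵇ c)
  inverse : ∀ c → c < m → g c < m × f (g c) ≡ c
  inverse c c< with injection⇒surjection m f into inj c c<
  ... | i , i< , fi≡c = firstBelow-< m _ i i< (≡ᵇ-true⁺ fi≡c)
                      , ≡ᵇ-true⁻ (proj₂ (firstBelow-spec m _ i i< (≡ᵇ-true⁺ fi≡c)))

countBelow-mono : ∀ {m m'} (p : ℕ → Bool) → m ≤ m' → countBelow m p ≤ countBelow m' p
countBelow-mono {m} {zero}   p z≤n = ≤-refl
countBelow-mono {m} {suc m'} p le with m ≟ suc m'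
... | yes refl = ≤-refl
... | no  m≢   = ≤-trans (countBelow-mono p (≤-pred (≤∧≢⇒< le m≢))) (m≤m+n _ _)

length-filter-snoc : ∀ (q : ℕ → Bool) xs x → length (filterᵇ q (xs ++ x ∷ [])) ≡ length (filterᵇ q xs) + indicator (q x)
length-filter-snoc q []       x with q x
... | true  = refl
... | false = refl
length-filter-snoc q (y ∷ xs) x with q y
... | true  = cong suc (length-filter-snoc q xs x)
... | false = length-filter-snoc q xs x

length-filter-not : ∀ m (p : ℕ → Bool) → length (filterᵇ (not ∘ p) (upTo m)) + countBelow m p ≡ m
length-filter-not zero    p = refl
length-filter-not (suc m) p =
  trans (cong (_+ countBelow (suc m) p)
              (trans (cong (length ∘ filterᵇ (not ∘ p)) (sym (upTo-∷ʳ m))) (length-filter-snoc (not ∘ p) (upTo m) m)))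
        (step (length (filterᵇ (not ∘ p) (upTo m))) (countBelow m p) (p m) (length-filter-not m p))
  where
  step : ∀ a c b → a + c ≡ m → a + indicator (not b) + (c + indicator b) ≡ suc m
  step a c b e = trans (interchange a (indicator (not b)) c (indicator b))
                       (trans (cong₂ _+_ e (one b)) (+-comm m 1))
    where
    one : ∀ b → indicator (not b) + indicator b ≡ 1
    one true  = refl
    one false = refl

any-true⁻ : ∀ {A : Set} (p : A → Bool) xs → any p xs ≡ true → ∃[ x ] (x ∈ xs × p x ≡ true)
any-true⁻ p (x ∷ xs) e with ∨-true⁻ {p x} e
... | inj₁ px = x , here refl , px
... | inj₂ e' with any-true⁻ p xs e'
...   | y , y∈ , py = y , there y∈ , py

any-true⁺ : ∀ {A : Set} (p : A → Bool) {xs x} → x ∈ xs → p x ≡ true → any p xs ≡ true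
any-true⁺ p (here refl) e = ∨-trueˡ e
any-true⁺ p {y ∷ xs} (there x∈) e = ∨-trueʳ {p y} (any-true⁺ p x∈ e)

any-map : ∀ {A B : Set} (p : B → Bool) (g : A → B) xs → any p (map g xs) ≡ any (p ∘ g) xs
any-map p g []       = refl
any-map p g (x ∷ xs) = cong (p (g x) ∨_) (any-map p g xs)

any-cong : ∀ {A : Set} {p q : A → Bool} xs → (∀ x → x ∈ xs → p x ≡ q x) → any p xs ≡ any q xs
any-cong []       h = refl
any-cong (x ∷ xs) h = cong₂ _∨_ (h x (here refl)) (any-cong xs (λ y y∈ → h y (there y∈)))

suc[m∸suc-n]≡m∸n : ∀ m n → suc n ≤ m → suc (m ∸ suc n) ≡ m ∸ n
suc[m∸suc-n]≡m∸n (suc m) zero    _         = refl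
suc[m∸suc-n]≡m∸n (suc m) (suc n) (s≤s le) = suc[m∸suc-n]≡m∸n m n le

m∸suc[b∸suc-s]≡m∸b+s : ∀ m b s → suc s ≤ b → b ≤ m → m ∸ suc (b ∸ suc s) ≡ m ∸ b + s
m∸suc[b∸suc-s]≡m∸b+s m b zero    le₁ le₂ = trans (cong (m ∸_) (suc[m∸suc-n]≡m∸n b 0 le₁)) (sym (+-identityʳ _))
m∸suc[b∸suc-s]≡m∸b+s m b (suc s) le₁ le₂ = begin
    m ∸ suc (b ∸ suc (suc s))   ≡⟨ cong (m ∸_) (suc[m∸suc-n]≡m∸n b (suc s) le₁) ⟩
    m ∸ (b ∸ suc s)             ≡⟨ sym (suc[m∸suc-n]≡m∸n m (b ∸ suc s) b∸suc-s<m) ⟩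
    suc (m ∸ suc (b ∸ suc s))   ≡⟨ cong suc (m∸suc[b∸suc-s]≡m∸b+s m b s (≤-trans (n≤1+n _) le₁) le₂) ⟩
    suc (m ∸ b + s)             ≡⟨ sym (+-suc (m ∸ b) s) ⟩
    m ∸ b + suc s               ∎
  where
  open ≡-Reasoning
  b∸suc-s<m : suc (b ∸ suc s) ≤ m
  b∸suc-s<m = ≤-trans (≤-reflexive (suc[m∸suc-n]≡m∸n b s (≤-trans (n≤1+n _) le₁))) (≤-trans (m∸n≤m b s) le₂)

applyUpTo-cong : ∀ {A : Set} len {f g : ℕ → A} → (∀ t → t < len → f t ≡ g t) → applyUpTo f len ≡ applyUpTo g len
applyUpTo-cong zero      h = refl
applyUpTo-cong (suc len) h = cong₂ _∷_ (h 0 (s≤s z≤n)) (applyUpTo-cong len (λ t t< → h (suc t) (s≤s t<)))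

applyUpTo-≡⁻ : ∀ {A : Set} len {f g : ℕ → A} → applyUpTo f len ≡ applyUpTo g len → ∀ t → t < len → f t ≡ g t
applyUpTo-≡⁻ (suc len) e zero    t< = proj₁ (∷-injective e)
applyUpTo-≡⁻ (suc len) e (suc t) t< = applyUpTo-≡⁻ len (proj₂ (∷-injective e)) t (≤-pred t<)

take-applyUpTo : ∀ {A : Set} k (f : ℕ → A) → take k (applyUpTo f (suc k)) ≡ applyUpTo f k
take-applyUpTo zero    f = refl
take-applyUpTo (suc k) f = cong (f 0 ∷_) (take-applyUpTo k (f ∘ suc))

-- a word is determined by its length-k prefix and its suffix from position 1 (k ≥ 1):
-- an edge of the de Bruijn graph is determined by its two end nodes
take-drop-injective : ∀ k → 1 ≤ k → ∀ (a b : List ℕ) → take k a ≡ take k b → drop 1 a ≡ drop 1 b → a ≡ b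
take-drop-injective (suc k) _ []      []      _  _  = refl
take-drop-injective (suc k) _ (x ∷ a) (y ∷ b) e₁ e₂ = cong₂ _∷_ (proj₁ (∷-injective e₁)) e₂

-- the s-th node of a path (the empty node out of range)
nth : List (List ℕ) → ℕ → List ℕ
nth []       _       = []
nth (x ∷ xs) zero    = x
nth (x ∷ xs) (suc m) = nth xs m

nth-applyUpTo : ∀ W (f : ℕ → List ℕ) s → s < W → nth (applyUpTo f W) s ≡ f s
nth-applyUpTo (suc W) f zero    _  = refl
nth-applyUpTo (suc W) f (suc s) lt = nth-applyUpTo W (f ∘ suc) s (≤-pred lt)

lastNode≡nth : ∀ p → p ≢ [] → lastNode p ≡ nth p (length p ∸ 1)
lastNode≡nth []           ne = ⊥-elim (ne refl)
lastNode≡nth (x ∷ [])     ne = refl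
lastNode≡nth (x ∷ y ∷ xs) ne = lastNode≡nth (y ∷ xs) (λ ())

length≥1 : ∀ (p : List (List ℕ)) → p ≢ [] → 1 ≤ length p
length≥1 []      ne = ⊥-elim (ne refl)
length≥1 (_ ∷ _) _  = s≤s z≤n

Linked-nth : ∀ {R : List ℕ → List ℕ → Set} p → Linked R p → ∀ s → suc s < length p → R (nth p s) (nth p (suc s))
Linked-nth (x ∷ y ∷ xs) (r ∷ l) zero    _  = r
Linked-nth (x ∷ y ∷ xs) (r ∷ l) (suc s) lt = Linked-nth (y ∷ xs) l s (≤-pred lt)
Linked-nth (x ∷ [])     [-]     s       (s≤s ())

Linked-∷ʳ : ∀ {R : List ℕ → List ℕ → Set} p z → Linked R (p ∷ʳ z) → p ≢ [] → R (lastNode p) z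
Linked-∷ʳ []           z l       ne = ⊥-elim (ne refl)
Linked-∷ʳ (x ∷ [])     z (r ∷ _) ne = r
Linked-∷ʳ (x ∷ y ∷ xs) z (_ ∷ l) ne = Linked-∷ʳ (y ∷ xs) z l (λ ())

Linked-applyUpTo : ∀ {R : List ℕ → List ℕ → Set} W (f : ℕ → List ℕ) → (∀ s → suc s < W → R (f s) (f (suc s))) →
  Linked R (applyUpTo f W)
Linked-applyUpTo zero             f h = []
Linked-applyUpTo (suc zero)       f h = [-]
Linked-applyUpTo (suc (suc W))    f h =
  h 0 (s≤s (s≤s z≤n)) ∷ Linked-applyUpTo (suc W) (f ∘ suc) (λ s lt → h (suc s) (s≤s lt))

Unique-applyUpTo : ∀ W (f : ℕ → List ℕ) → (∀ s s' → s < s' → s' < W → f s ≢ f s') → Unique (applyUpTo f W)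
Unique-applyUpTo zero    f h = []
Unique-applyUpTo (suc W) f h =
  applyUpTo⁺₁ (f ∘ suc) W (λ {i} lt → h 0 (suc i) (s≤s z≤n) (s≤s lt)) ∷
  Unique-applyUpTo W (f ∘ suc) (λ s s' lt lt' → h (suc s) (suc s') (s≤s lt) (s≤s lt'))

sum-cong : ∀ (D : List (List ℕ)) {F G : List ℕ → ℕ} → (∀ z → z ∈ D → F z ≡ G z) → sum (map F D) ≡ sum (map G D)
sum-cong D h = cong sum (map-cong-local (All-tabulate (λ {z} z∈ → h z z∈)))

sum-+ : ∀ (D : List (List ℕ)) (F G : List ℕ → ℕ) → sum (map (λ z → F z + G z) D) ≡ sum (map F D) + sum (map G D)
sum-+ []      F G = refl
sum-+ (x ∷ D) F G = trans (cong (F x + G x +_) (sum-+ D F G)) (interchange (F x) (G x) (sum (map F D)) (sum (map G D)))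

sum-zero : ∀ (D : List (List ℕ)) (F : List ℕ → ℕ) → (∀ z → z ∈ D → F z ≡ 0) → sum (map F D) ≡ 0
sum-zero []      F h = refl
sum-zero (x ∷ D) F h rewrite h x (here refl) = sum-zero D F (λ z z∈ → h z (there z∈))

sum-indicator-point : ∀ (D : List (List ℕ)) x c → x ∈ D → Unique D →
  sum (map (λ z → indicator ((x ==ₗ z) ∧ c)) D) ≡ indicator c
sum-indicator-point (y ∷ D) x c (here refl) (x∉D ∷ _) rewrite ==ₗ-true⁺ {x} refl =
  trans (cong (indicator c +_) (sum-zero D _ (λ z z∈ → vanish z (All-lookup x∉D z∈)))) (+-identityʳ _)
  where
  vanish : ∀ z → x ≢ z → indicator ((x ==ₗ z) ∧ c) ≡ 0
  vanish z x≢z with x ==ₗ z in e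
  ... | false = refl
  ... | true  = ⊥-elim (x≢z (==ₗ-true⁻ e))
sum-indicator-point (y ∷ D) x c (there x∈) (y∉D ∷ u) with x ==ₗ y in e
... | true  = ⊥-elim (All-lookup y∉D x∈ (sym (==ₗ-true⁻ e)))
... | false = sum-indicator-point D x c x∈ u

countBelow-groupBy : ∀ m (D : List (List ℕ)) (key : ℕ → List ℕ) (b : ℕ → Bool) → Unique D → (∀ t → t < m → key t ∈ D) →
  sum (map (λ z → countBelow m (λ t → (key t ==ₗ z) ∧ b t)) D) ≡ countBelow m b
countBelow-groupBy zero    D key b u inD = sum-zero D _ (λ _ _ → refl)
countBelow-groupBy (suc m) D key b u inD =
  trans (sum-+ D (λ z → countBelow m (λ t → (key t ==ₗ z) ∧ b t)) (λ z → indicator ((key m ==ₗ z) ∧ b m)))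
        (cong₂ _+_ (countBelow-groupBy m D key b u (λ t t< → inD t (m<n⇒m<1+n t<)))
                   (sum-indicator-point D (key m) (b m) (inD m ≤-refl) u))

module Tunneling (S : List ℕ) {{_ : NonZero (length S)}} (endMarked : IsEndMarked S)
                 (k : ℕ) (k≥1 : 1 ≤ k) (sa : ℕ → ℕ) (sorted : IsSortedRotations S sa) where

  n : ℕ
  n = length S

  sc : ℕ → ℕ
  sc = Sc S

  node : ℕ → List ℕ
  node s = cyc S s k

  kmer : ℕ → List ℕ
  kmer s = cyc S s (suc k)

  cyc-applyUpTo : ∀ i len → cyc S i len ≡ applyUpTo (λ t → sc (i + t)) len
  cyc-applyUpTo i len = map-upTo (λ t → sc (i + t)) len

  cyc-cong : ∀ i i' len → (∀ t → t < len → sc (i + t) ≡ sc (i' + t)) → cyc S i len ≡ cyc S i' len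
  cyc-cong i i' len h = trans (cyc-applyUpTo i len) (trans (applyUpTo-cong len h) (sym (cyc-applyUpTo i' len)))

  cyc-≡⁻ : ∀ i i' len → cyc S i len ≡ cyc S i' len → ∀ t → t < len → sc (i + t) ≡ sc (i' + t)
  cyc-≡⁻ i i' len e = applyUpTo-≡⁻ len (trans (sym (cyc-applyUpTo i len)) (trans e (cyc-applyUpTo i' len)))

  %-shift : ∀ a b → (a % n + b) % n ≡ (a + b) % n
  %-shift a b = trans (%-distribˡ-+ (a % n) b n)
                  (trans (cong (λ z → (z + b % n) % n) (m%n%n≡m%n a n)) (sym (%-distribˡ-+ a b n)))

  sc-% : ∀ a b → sc (a % n + b) ≡ sc (a + b)
  sc-% a b = cong (charAt S) (%-shift a b)

  sc-%n : ∀ a → sc (a % n) ≡ sc a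
  sc-%n a = trans (cong sc (sym (+-identityʳ (a % n)))) (trans (sc-% a 0) (cong sc (+-identityʳ a)))

  sc-+n : ∀ a → sc (a + n) ≡ sc a
  sc-+n a = cong (charAt S) ([m+n]%n≡m%n a n)

  sc-<n : ∀ a → a < n → sc a ≡ charAt S a
  sc-<n a a< = cong (charAt S) (m<n⇒m%n≡m a<)

  cyc-% : ∀ i len → cyc S (i % n) len ≡ cyc S i len
  cyc-% i len = cyc-cong (i % n) i len (λ t _ → sc-% i t)

  cyc-+n : ∀ i len → cyc S (i + n) len ≡ cyc S i len
  cyc-+n i len = cyc-cong (i + n) i len (λ t _ → trans (cong sc (shift t)) (sc-+n (i + t)))
    where
    shift : ∀ t → i + n + t ≡ i + t + n
    shift t = trans (+-assoc i n t) (trans (cong (i +_) (+-comm n t)) (sym (+-assoc i t n)))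

  take-kmer : ∀ s → take k (kmer s) ≡ node s
  take-kmer s rewrite cyc-applyUpTo s (suc k) | cyc-applyUpTo s k = take-applyUpTo k (λ t → sc (s + t))

  drop-kmer : ∀ s → drop 1 (kmer s) ≡ node (suc s)
  drop-kmer s = trans (map-applyUpTo suc (λ t → sc (s + t)) k)
                  (trans (applyUpTo-cong k (λ t _ → cong sc (+-suc s t))) (sym (cyc-applyUpTo (suc s) k)))

  node-head : ∀ a b → node a ≡ node b → sc a ≡ sc b
  node-head a b e = trans (cong sc (sym (+-identityʳ a))) (trans (cyc-≡⁻ a b k e 0 k≥1) (cong sc (+-identityʳ b)))

  n≥1 : 1 ≤ n
  n≥1 = >-nonZero⁻¹ n

  suc[n∸1]≡n : suc (n ∸ 1) ≡ n
  suc[n∸1]≡n = m+[n∸m]≡n n≥1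

  prev : ℕ → ℕ
  prev t = (t + (n ∸ 1)) % n

  next : ℕ → ℕ
  next t = suc t % n

  prev< : ∀ t → prev t < n
  prev< t = m%n<n _ n

  next< : ∀ t → next t < n
  next< t = m%n<n _ n

  next-prev : ∀ t → t < n → next (prev t) ≡ t
  next-prev t t< = begin
      suc ((t + (n ∸ 1)) % n) % n     ≡⟨ cong (_% n) (+-comm 1 _) ⟩
      ((t + (n ∸ 1)) % n + 1) % n     ≡⟨ %-shift (t + (n ∸ 1)) 1 ⟩
      (t + (n ∸ 1) + 1) % n           ≡⟨ cong (_% n) (trans (+-assoc t (n ∸ 1) 1) (cong (t +_) (trans (+-comm (n ∸ 1) 1) suc[n∸1]≡n))) ⟩
      (t + n) % n                     ≡⟨ [m+n]%n≡m%n t n ⟩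
      t % n                           ≡⟨ m<n⇒m%n≡m t< ⟩
      t                               ∎
    where open ≡-Reasoning

  prev-next-% : ∀ t → prev (next t) ≡ t % n
  prev-next-% t = begin
      (suc t % n + (n ∸ 1)) % n       ≡⟨ %-shift (suc t) (n ∸ 1) ⟩
      (suc t + (n ∸ 1)) % n           ≡⟨ cong (_% n) (trans (sym (+-suc t (n ∸ 1))) (cong (t +_) suc[n∸1]≡n)) ⟩
      (t + n) % n                     ≡⟨ [m+n]%n≡m%n t n ⟩
      t % n                           ∎
    where open ≡-Reasoning

  prev-next : ∀ t → t < n → prev (next t) ≡ t
  prev-next t t< = trans (prev-next-% t) (m<n⇒m%n≡m t<)

  prev-injective : ∀ a b → a < n → b < n → prev a ≡ prev b → a ≡ b
  prev-injective a b a< b< e = trans (sym (next-prev a a<)) (trans (cong next e) (next-prev b b<))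

  next-injective : ∀ a b → a < n → b < n → next a ≡ next b → a ≡ b
  next-injective a b a< b< e = trans (sym (prev-next a a<)) (trans (cong prev e) (prev-next b b<))

  sc-suc-prev : ∀ t u → sc (suc (prev t) + u) ≡ sc (t + u)
  sc-suc-prev t u = begin
      sc (suc (prev t) + u)           ≡⟨ cong sc (sym (+-suc (prev t) u)) ⟩
      sc (prev t + suc u)             ≡⟨ sc-% (t + (n ∸ 1)) (suc u) ⟩
      sc (t + (n ∸ 1) + suc u)        ≡⟨ cong sc (reorder t (n ∸ 1) u) ⟩
      sc (t + u + suc (n ∸ 1))        ≡⟨ cong (λ z → sc (t + u + z)) suc[n∸1]≡n ⟩
      sc (t + u + n)                  ≡⟨ sc-+n (t + u) ⟩
      sc (t + u)                      ∎
    where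
    open ≡-Reasoning
    reorder : ∀ a b c → a + b + suc c ≡ a + c + suc b
    reorder a b c = begin
      a + b + suc c   ≡⟨ +-assoc a b (suc c) ⟩
      a + (b + suc c) ≡⟨ cong (a +_) (trans (+-suc b c) (cong suc (+-comm b c))) ⟩
      a + suc (c + b) ≡⟨ cong (a +_) (sym (+-suc c b)) ⟩
      a + (c + suc b) ≡⟨ sym (+-assoc a c (suc b)) ⟩
      a + c + suc b   ∎

  sc-prev : ∀ t → sc (prev t) ≡ sc (t + (n ∸ 1))
  sc-prev t = sc-%n (t + (n ∸ 1))

  node-suc-prev : ∀ t → node (suc (prev t)) ≡ node t
  node-suc-prev t = cyc-cong _ _ k (λ u _ → sc-suc-prev t u)

  node-suc-% : ∀ s → node (suc (s % n)) ≡ node (suc s)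
  node-suc-% s = cyc-cong _ _ k (λ t _ → trans (cong sc (sym (+-suc (s % n) t))) (trans (sc-% s (suc t)) (cong sc (+-suc s t))))

  RL : ℕ → ℕ → Set
  RL = RotLt S

  RL-irrefl : ∀ i → ¬ RL i i
  RL-irrefl i (j , _ , _ , lt) = <-irrefl refl lt

  RL-asym : ∀ a b → RL a b → ¬ RL b a
  RL-asym a b (j , _ , agree , lt) (j' , _ , agree' , lt') with <-cmp j j'
  ... | tri< j<j' _ _ = <-irrefl (sym (agree' j j<j')) lt
  ... | tri≈ _ refl _ = <-asym lt lt'
  ... | tri> _ _ j>j' = <-irrefl (sym (agree j' j>j')) lt'

  RL-cong : ∀ x x' y y' → (∀ t → sc (x + t) ≡ sc (x' + t)) → (∀ t → sc (y + t) ≡ sc (y' + t)) → RL x y → RL x' y'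
  RL-cong x x' y y' hx hy (j , j< , agree , lt) =
    j , j< , (λ t t< → trans (sym (hx t)) (trans (agree t t<) (hy t))) , subst₂ _<_ (hx j) (hy j) lt

  RL-intro : ∀ x y j → (∀ t → t < j → sc (x + t) ≡ sc (y + t)) → sc (x + j) < sc (y + j) → RL x y
  RL-intro x y j agree lt with j <? n
  ... | yes j< = j , j< , agree , lt
  ... | no  _  = j % n , m%n<n j n , (λ t t< → agree t (<-≤-trans t< (m%n≤m j n))) , subst₂ _<_ (sym (reduce x)) (sym (reduce y)) lt
    where
    reduce : ∀ z → sc (z + j % n) ≡ sc (z + j)
    reduce z = trans (cong sc (+-comm z (j % n))) (trans (sc-% j z) (cong sc (+-comm j z)))

  RL-step⁻ : ∀ x y → RL x y → sc x < sc y ⊎ (sc x ≡ sc y × RL (suc x) (suc y))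
  RL-step⁻ x y (zero , _ , _ , lt) = inj₁ (subst₂ _<_ (cong sc (+-identityʳ x)) (cong sc (+-identityʳ y)) lt)
  RL-step⁻ x y (suc j , j< , agree , lt) =
    inj₂ ( trans (cong sc (sym (+-identityʳ x))) (trans (agree 0 (s≤s z≤n)) (cong sc (+-identityʳ y)))
         , ( j , <-trans (n<1+n j) j<
           , (λ t t< → subst₂ _≡_ (cong sc (+-suc x t)) (cong sc (+-suc y t)) (agree (suc t) (s≤s t<)))
           , subst₂ _<_ (cong sc (+-suc x j)) (cong sc (+-suc y j)) lt))

  RL-step⁺ : ∀ x y → sc x < sc y ⊎ (sc x ≡ sc y × RL (suc x) (suc y)) → RL x y
  RL-step⁺ x y (inj₁ lt) =
    RL-intro x y 0 (λ t ()) (subst₂ _<_ (cong sc (sym (+-identityʳ x))) (cong sc (sym (+-identityʳ y))) lt)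
  RL-step⁺ x y (inj₂ (head≡ , (j , _ , agree , lt))) =
    RL-intro x y (suc j) agree' (subst₂ _<_ (cong sc (sym (+-suc x j))) (cong sc (sym (+-suc y j))) lt)
    where
    agree' : ∀ t → t < suc j → sc (x + t) ≡ sc (y + t)
    agree' zero    _  = subst₂ _≡_ (cong sc (sym (+-identityʳ x))) (cong sc (sym (+-identityʳ y))) head≡
    agree' (suc t) t< = subst₂ _≡_ (cong sc (sym (+-suc x t))) (cong sc (sym (+-suc y t))) (agree t (≤-pred t<))

  sa< : ∀ r → r < n → sa r < n
  sa< = proj₁ sorted

  row-order : ∀ a b → a < n → b < n → RL (sa a) (sa b) → a < b
  row-order a b a< b< rl with <-cmp a b
  ... | tri< lt _ _   = lt
  ... | tri≈ _ refl _ = ⊥-elim (RL-irrefl _ rl)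
  ... | tri> _ _ gt   = ⊥-elim (RL-asym _ _ rl (proj₂ sorted b a gt a<))

  sa-injective : ∀ a b → a < n → b < n → sa a ≡ sa b → a ≡ b
  sa-injective a b a< b< e with <-cmp a b
  ... | tri< lt _ _ = ⊥-elim (RL-irrefl (sa b) (subst (λ z → RL z (sa b)) e (proj₂ sorted a b lt b<)))
  ... | tri≈ _ eq _ = eq
  ... | tri> _ _ gt = ⊥-elim (RL-irrefl (sa a) (subst (λ z → RL z (sa a)) (sym e) (proj₂ sorted b a gt a<)))

  pos : ℕ → ℕ
  pos t = firstBelow n (λ r → sa r ≡ᵇ t)

  pos-spec : ∀ t → t < n → pos t < n × sa (pos t) ≡ t
  pos-spec t t< with injection⇒surjection n sa sa< sa-injective t t<
  ... | i , i< , e = firstBelow-< n _ i i< (≡ᵇ-true⁺ e) , ≡ᵇ-true⁻ (proj₂ (firstBelow-spec n _ i i< (≡ᵇ-true⁺ e)))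

  pos< : ∀ t → t < n → pos t < n
  pos< t t< = proj₁ (pos-spec t t<)

  sa-pos : ∀ t → t < n → sa (pos t) ≡ t
  sa-pos t t< = proj₂ (pos-spec t t<)

  pos-sa : ∀ r → r < n → pos (sa r) ≡ r
  pos-sa r r< = sa-injective _ _ (pos< (sa r) (sa< r r<)) r< (sa-pos (sa r) (sa< r r<))

  pos-injective : ∀ a b → a < n → b < n → pos a ≡ pos b → a ≡ b
  pos-injective a b a< b< e = trans (sym (sa-pos a a<)) (trans (cong sa e) (sa-pos b b<))

  -- (1) LF moves to the rotation starting one position earlier

  Lc : ℕ → ℕ
  Lc = L S sa

  lf : ℕ → ℕ
  lf = LF S sa

  σ : ℕ → ℕ
  σ r = pos (prev (sa r))

  σ< : ∀ r → r < n → σ r < n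
  σ< r r< = pos< _ (prev< _)

  σ-injective : ∀ a b → a < n → b < n → σ a ≡ σ b → a ≡ b
  σ-injective a b a< b< e =
    sa-injective a b a< b< (prev-injective _ _ (sa< a a<) (sa< b b<) (pos-injective _ _ (prev< _) (prev< _) e))

  L≡sc-prev : ∀ r → Lc r ≡ sc (prev (sa r))
  L≡sc-prev r = sym (sc-prev (sa r))

  sc-sa-σ : ∀ r → r < n → sc (sa (σ r)) ≡ Lc r
  sc-sa-σ r r< = trans (cong sc (sa-pos _ (prev< _))) (sym (L≡sc-prev r))

  pos-next-σ : ∀ r → r < n → pos (next (sa (σ r))) ≡ r
  pos-next-σ r r< =
    trans (cong (λ z → pos (next z)) (sa-pos _ (prev< _))) (trans (cong pos (next-prev _ (sa< r r<))) (pos-sa r r<))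

  before-σ : ∀ r r' → r < n → r' < n →
    (r' <ᵇ σ r) ≡ ((sc (sa r') <ᵇ Lc r) ∨ ((sc (sa r') ≡ᵇ Lc r) ∧ (pos (next (sa r')) <ᵇ r)))
  before-σ r r' r< r'< = Bool-≡ to from
    where
    p : ℕ
    p = prev (sa r)
    p< : p < n
    p< = prev< (sa r)
    c : ℕ
    c = Lc r
    sc-p : sc p ≡ c
    sc-p = sym (L≡sc-prev r)
    sa-next< : next (sa r') < n
    sa-next< = next< (sa r')
    shift : RL (suc (sa r')) (suc p) → RL (sa (pos (next (sa r')))) (sa r)
    shift = RL-cong _ _ _ _ (λ t → trans (sym (sc-% (suc (sa r')) t)) (cong (λ z → sc (z + t)) (sym (sa-pos _ sa-next<))))
                            (sc-suc-prev (sa r))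
    unshift : RL (sa (pos (next (sa r')))) (sa r) → RL (suc (sa r')) (suc p)
    unshift = RL-cong _ _ _ _ (λ t → trans (cong (λ z → sc (z + t)) (sa-pos _ sa-next<)) (sc-% (suc (sa r')) t))
                              (λ t → sym (sc-suc-prev (sa r) t))
    to : (r' <ᵇ pos p) ≡ true → ((sc (sa r') <ᵇ c) ∨ ((sc (sa r') ≡ᵇ c) ∧ (pos (next (sa r')) <ᵇ r))) ≡ true
    to e with RL-step⁻ (sa r') p (subst (RL (sa r')) (sa-pos p p<) (proj₂ sorted r' (pos p) (<ᵇ-true⁻ e) (pos< p p<)))
    ... | inj₁ lt = ∨-trueˡ (<ᵇ-true⁺ (subst (sc (sa r') <_) sc-p lt))
    ... | inj₂ (eq , rl) =
      ∨-trueʳ {sc (sa r') <ᵇ c} (∧-true⁺ (≡ᵇ-true⁺ (trans eq sc-p)) (<ᵇ-true⁺ (row-order _ _ (pos< _ sa-next<) r< (shift rl))))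
    from : ((sc (sa r') <ᵇ c) ∨ ((sc (sa r') ≡ᵇ c) ∧ (pos (next (sa r')) <ᵇ r))) ≡ true → (r' <ᵇ pos p) ≡ true
    from e = <ᵇ-true⁺ (row-order r' (pos p) r'< (pos< p p<)
               (subst (RL (sa r')) (sym (sa-pos p p<)) (RL-step⁺ _ _ (cases (∨-true⁻ {sc (sa r') <ᵇ c} e)))))
      where
      cases : (sc (sa r') <ᵇ c) ≡ true ⊎ ((sc (sa r') ≡ᵇ c) ∧ (pos (next (sa r')) <ᵇ r)) ≡ true →
              sc (sa r') < sc p ⊎ (sc (sa r') ≡ sc p × RL (suc (sa r')) (suc p))
      cases (inj₁ lt) = inj₁ (subst (sc (sa r') <_) (sym sc-p) (<ᵇ-true⁻ lt))
      cases (inj₂ eq) with ∧-true⁻ {sc (sa r') ≡ᵇ c} eq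
      ... | head≡ , before = inj₂ (trans (≡ᵇ-true⁻ head≡) (sym sc-p) , unshift (proj₂ sorted _ _ (<ᵇ-true⁻ before) r<))

  LF-formula : ∀ r → r < n → lf r ≡ Ccount S sa (Lc r) + rank S sa (Lc r) r
  LF-formula r r< rewrite ≡ᵇ-true⁺ {Lc r} refl =
    trans (cong (_∸ 1) (sym (+-assoc (Ccount S sa (Lc r)) (rank S sa (Lc r) r) 1))) (m+n∸n≡m _ 1)

  -- LF = σ: count the rows before σ r with `before-σ`, substituting r' = σ r''
  LF≡σ : ∀ r → r < n → lf r ≡ σ r
  LF≡σ r r< = trans (LF-formula r r<) (sym (begin
      σ r                                                                        ≡⟨ sym (countBelow-<ᵇ n (σ r) (<⇒≤ (σ< r r<))) ⟩
      countBelow n (λ r' → r' <ᵇ σ r)                                            ≡⟨ countBelow-cong n (λ r' r'< → before-σ r r' r< r'<) ⟩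
      countBelow n (λ r' → (F r' <ᵇ c) ∨ ((F r' ≡ᵇ c) ∧ B r'))                   ≡⟨ countBelow-∨ n _ _ (λ i _ → disjoint i) ⟩
      countBelow n (λ r' → F r' <ᵇ c) + countBelow n (λ r' → (F r' ≡ᵇ c) ∧ B r') ≡⟨ cong₂ _+_ smaller equal ⟩
      Ccount S sa c + rank S sa c r                                              ∎))
    where
    open ≡-Reasoning
    c : ℕ
    c = Lc r
    F : ℕ → ℕ
    F r' = sc (sa r')
    B : ℕ → Bool
    B r' = pos (next (sa r')) <ᵇ r
    disjoint : ∀ i → (F i <ᵇ c) ≡ true → ((F i ≡ᵇ c) ∧ B i) ≡ false
    disjoint i lt with F i ≡ᵇ c in eq
    ... | false = refl
    ... | true  = ⊥-elim (<-irrefl (≡ᵇ-true⁻ {F i} {c} eq) (<ᵇ-true⁻ {F i} {c} lt))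
    smaller : countBelow n (λ r' → F r' <ᵇ c) ≡ Ccount S sa c
    smaller = trans (sym (countBelow-permute n σ (λ r' → F r' <ᵇ c) σ< σ-injective))
                    (countBelow-cong n (λ i i< → cong (_<ᵇ c) (sc-sa-σ i i<)))
    equal : countBelow n (λ r' → (F r' ≡ᵇ c) ∧ B r') ≡ rank S sa c r
    equal = trans (sym (countBelow-permute n σ (λ r' → (F r' ≡ᵇ c) ∧ B r') σ< σ-injective))
              (trans (countBelow-cong n (λ i i< → cong₂ (λ a b → (a ≡ᵇ c) ∧ (b <ᵇ r)) (sc-sa-σ i i<) (pos-next-σ i i<)))
                     (countBelow-restrict n r (λ i → Lc i ≡ᵇ c) (<⇒≤ r<)))

  lf< : ∀ r → r < n → lf r < n
  lf< r r< = subst (_< n) (sym (LF≡σ r r<)) (σ< r r<)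

  sa-lf : ∀ r → r < n → sa (lf r) ≡ prev (sa r)
  sa-lf r r< = trans (cong sa (LF≡σ r r<)) (sa-pos _ (prev< _))

  lf-injective : ∀ a b → a < n → b < n → lf a ≡ lf b → a ≡ b
  lf-injective a b a< b< e = σ-injective a b a< b< (trans (sym (LF≡σ a a<)) (trans e (LF≡σ b b<)))

  lf-mono : ∀ r r' → r < r' → r' < n → Lc r ≡ Lc r' → lf r < lf r'
  lf-mono r r' lt r'< eq rewrite LF-formula r (<-trans lt r'<) | LF-formula r' r'< | eq =
    +-monoʳ-< (Ccount S sa (Lc r')) (<-≤-trans rank-step (countBelow-mono _ lt))
    where
    rank-step : rank S sa (Lc r') r < rank S sa (Lc r') (suc r)
    rank-step rewrite eq | ≡ᵇ-true⁺ {Lc r'} refl = subst (rank S sa (Lc r') r <_) (+-comm 1 _) ≤-refl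

  lf-mono-≤ : ∀ r r' → r ≤ r' → r' < n → Lc r ≡ Lc r' → lf r ≤ lf r'
  lf-mono-≤ r r' le r'< eq with r ≟ r'
  ... | yes refl = ≤-refl
  ... | no  r≢r' = <⇒≤ (lf-mono r r' (≤∧≢⇒< le r≢r') r'< eq)

  iter-lf< : ∀ y r → r < n → iter y lf r < n
  iter-lf< zero    r r< = r<
  iter-lf< (suc y) r r< = lf< _ (iter-lf< y r r<)

  sa-iter-lf : ∀ y r → r < n → sa (iter y lf r) ≡ iter y prev (sa r)
  sa-iter-lf zero    r r< = refl
  sa-iter-lf (suc y) r r< = trans (sa-lf _ (iter-lf< y r r<)) (cong prev (sa-iter-lf y r r<))

  nd : ℕ → List ℕ
  nd r = node (sa r)

  firstRow : List ℕ → ℕ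
  firstRow v = firstBelow n (λ r → nd r ==ₗ v)

  lastRow : List ℕ → ℕ
  lastRow v = lastBelow n (λ r → nd r ==ₗ v)

  firstRow-spec : ∀ v r → r < n → nd r ≡ v → firstRow v ≤ r × firstRow v < n × nd (firstRow v) ≡ v
  firstRow-spec v r r< e with firstBelow-spec n (λ r → nd r ==ₗ v) r r< (==ₗ-true⁺ e)
  ... | le , found = le , ≤-<-trans le r< , ==ₗ-true⁻ found

  lastRow< : ∀ v → lastRow v < n
  lastRow< v = subst (λ m → lastBelow m (λ r → nd r ==ₗ v) < m) suc[n∸1]≡n (lastBelow-< (n ∸ 1) _)

  block-contiguous : ∀ r₁ r r₂ v → r₁ < r → r < r₂ → r₂ < n → nd r₁ ≡ v → nd r₂ ≡ v → nd r ≡ v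
  block-contiguous r₁ r r₂ v lt₁ lt₂ r₂< e₁ e₂ = trans (cyc-cong _ _ k agree) e₁
    where
    r< : r < n
    r< = <-trans lt₂ r₂<
    ends-agree : ∀ t → t < k → sc (sa r₁ + t) ≡ sc (sa r₂ + t)
    ends-agree = cyc-≡⁻ _ _ k (trans e₁ (sym e₂))
    -- the first difference j₁ between rows r₁ and r is at least k
    agree : ∀ t → t < k → sc (sa r + t) ≡ sc (sa r₁ + t)
    agree t t< with proj₂ sorted r₁ r lt₁ r< | proj₂ sorted r r₂ lt₂ r₂<
    ... | (j₁ , _ , g₁ , l₁) | (j₂ , _ , g₂ , l₂) with t <? j₁
    ...   | yes t<j₁ = sym (g₁ t t<j₁)
    ...   | no  t≮j₁ = ⊥-elim (early (≤-<-trans (≮⇒≥ t≮j₁) t<))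
      where
      early : j₁ < k → ⊥
      early j₁<k with <-cmp j₂ j₁
      ... | tri< j₂<j₁ _ _ = <-irrefl (trans (sym (g₁ j₂ j₂<j₁)) (ends-agree j₂ (<-trans j₂<j₁ j₁<k))) l₂
      ... | tri≈ _ refl _  = <-irrefl (ends-agree j₁ j₁<k) (<-trans l₁ l₂)
      ... | tri> _ _ j₁<j₂ = <-irrefl (trans (ends-agree j₁ j₁<k) (sym (g₂ j₁ j₁<j₂))) l₁

  inner-row : ∀ v d → d < lastRow v ∸ firstRow v →
    firstRow v < n × nd (firstRow v) ≡ v × suc (firstRow v) + d < n × nd (suc (firstRow v) + d) ≡ v
  inner-row v d d< with anyBelow n (λ r → nd r ==ₗ v) in occurs
  ... | false = ⊥-elim (n≮0 (subst (d <_) empty d<))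
    where
    empty : lastRow v ∸ firstRow v ≡ 0
    empty = trans (cong (_∸ firstRow v) (lastBelow-none n _ (anyBelow-false⁻ n _ occurs))) (0∸n≡0 (firstRow v))
  ... | true with anyBelow-true⁻ n _ occurs
  ... | r , r< , ndr with firstRow-spec v r r< (==ₗ-true⁻ ndr)
  ... | _ , i< , ndi = i< , ndi , y< , ndy
    where
    i : ℕ
    i = firstRow v
    j : ℕ
    j = lastRow v
    ndj : nd j ≡ v
    ndj = ==ₗ-true⁻ (proj₂ (lastBelow-spec n _ r r< ndr))
    i<j : i < j
    i<j = m∸n≢0⇒n<m (λ z → n≮0 (subst (d <_) z d<))
    y : ℕ
    y = suc i + d
    y≤j : y ≤ j
    y≤j = subst (_≤ j) (+-suc i d) (subst (i + suc d ≤_) (m+[n∸m]≡n (<⇒≤ i<j)) (+-monoʳ-≤ i d<))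
    y< : y < n
    y< = ≤-<-trans y≤j (lastRow< v)
    ndy : nd y ≡ v
    ndy with y ≟ j
    ... | yes y≡j = trans (cong nd y≡j) ndj
    ... | no  y≢j = block-contiguous i y j v (s≤s (m≤m+n i d)) (≤∧≢⇒< y≤j y≢j) (lastRow< v) ndi ndj

  Ed : List ℕ → List ℕ → Set
  Ed = Edge S k

  IF : List ℕ → List ℕ → Set
  IF = InF S k

  edge-at : ∀ s → Ed (node s) (node (suc s))
  edge-at s = s % n , m%n<n s n , trans (take-kmer (s % n)) (cyc-% s k) , trans (drop-kmer (s % n)) (node-suc-% s)

  F-next : ∀ {u v} → IF u v → ∀ s → node s ≡ u → node (suc s) ≡ v
  F-next (_ , onlySucc , _) s e = onlySucc (node (suc s)) (subst (λ z → Ed z (node (suc s))) e (edge-at s))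

  F-prev : ∀ {u v} → IF u v → ∀ s → node (suc s) ≡ v → node s ≡ u
  F-prev (_ , _ , onlyPred) s e = onlyPred (node s) (subst (Ed (node s)) e (edge-at s))

  inFb : List ℕ → List ℕ → Bool
  inFb u v = onlySuccᵇ S k u v ∧ onlyPredᵇ S k u v

  inFb⁻ : ∀ u v → Ed u v → inFb u v ≡ true → IF u v
  inFb⁻ u v edge e with ∧-true⁻ {onlySuccᵇ S k u v} e
  ... | succ , pred = edge , onlySucc , onlyPred
    where
    onlySucc : ∀ v' → Ed u v' → v' ≡ v
    onlySucc v' (i , i< , from , to) with ∨-true⁻ {not (take k (kmer i) ==ₗ u)} (allBelow-true⁻ n _ succ i i<)
    ... | inj₁ other = ⊥-elim (true≢false (trans (sym (==ₗ-true⁺ from)) (not-true⁻ other)))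
    ... | inj₂ same  = trans (sym to) (==ₗ-true⁻ same)
    onlyPred : ∀ u' → Ed u' v → u' ≡ u
    onlyPred u' (i , i< , from , to) with ∨-true⁻ {not (drop 1 (kmer i) ==ₗ v)} (allBelow-true⁻ n _ pred i i<)
    ... | inj₁ other = ⊥-elim (true≢false (trans (sym (==ₗ-true⁺ to)) (not-true⁻ other)))
    ... | inj₂ same  = trans (sym from) (==ₗ-true⁻ same)

  inFb⁺ : ∀ u v → IF u v → inFb u v ≡ true
  inFb⁺ u v (_ , onlySucc , onlyPred) = ∧-true⁺ (allBelow-true⁺ n _ succ) (allBelow-true⁺ n _ pred)
    where
    succ : ∀ i → i < n → (not (take k (kmer i) ==ₗ u) ∨ (drop 1 (kmer i) ==ₗ v)) ≡ true
    succ i i< with take k (kmer i) ==ₗ u in e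
    ... | false = refl
    ... | true  = ==ₗ-true⁺ (onlySucc _ (i , i< , ==ₗ-true⁻ e , refl))
    pred : ∀ i → i < n → (not (drop 1 (kmer i) ==ₗ v) ∨ (take k (kmer i) ==ₗ u)) ≡ true
    pred i i< with drop 1 (kmer i) ==ₗ v in e
    ... | false = refl
    ... | true  = ==ₗ-true⁺ (onlyPred _ (i , i< , refl , ==ₗ-true⁻ e))

  F-at : ℕ → Bool
  F-at s = inFᵇ S k (kmer s)

  F-at≡inFb : ∀ s → F-at s ≡ inFb (node s) (node (suc s))
  F-at≡inFb s = cong₂ inFb (take-kmer s) (drop-kmer s)

  F-at⁻ : ∀ s → F-at s ≡ true → IF (node s) (node (suc s))
  F-at⁻ s e = inFb⁻ _ _ (edge-at s) (trans (sym (F-at≡inFb s)) e)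

  F-at⁺ : ∀ s → IF (node s) (node (suc s)) → F-at s ≡ true
  F-at⁺ s f = trans (F-at≡inFb s) (inFb⁺ _ _ f)

  F-at-node : ∀ s s' → node s ≡ node s' → F-at s ≡ F-at s'
  F-at-node s s' e = Bool-≡ (transfer s s' e) (transfer s' s (sym e))
    where
    transfer : ∀ s s' → node s ≡ node s' → F-at s ≡ true → F-at s' ≡ true
    transfer s s' e inF with F-at⁻ s inF
    ... | f = F-at⁺ s' (subst₂ IF e (sym (F-next f s' (sym e))) f)

  F-at-+n : ∀ s → F-at (s + n) ≡ F-at s
  F-at-+n s = cong (inFᵇ S k) (cyc-+n s (suc k))

  F-at-% : ∀ s → F-at (s % n) ≡ F-at s
  F-at-% s = cong (inFᵇ S k) (cyc-% s (suc k))

  occ : List ℕ → ℕ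
  occ v = countBelow n (λ s → node s ==ₗ v)

  -- both ends of an F-edge occur equally often (`next` is a permutation)
  occ-F : ∀ {u v} → IF u v → occ u ≡ occ v
  occ-F {u} {v} f =
    trans (countBelow-cong n (λ s _ → Bool-≡ (λ e → ==ₗ-true⁺ (trans (cyc-% (suc s) k) (F-next f s (==ₗ-true⁻ e))))
                                              (λ e → ==ₗ-true⁺ (F-prev f s (trans (sym (cyc-% (suc s) k)) (==ₗ-true⁻ e))))))
          (countBelow-permute n next (λ s → node s ==ₗ v) (λ s _ → next< s) next-injective)

  n∸1<n : n ∸ 1 < n
  n∸1<n = subst (n ∸ 1 <_) suc[n∸1]≡n ≤-refl

  occ-end : occ (node (n ∸ 1)) ≡ 1
  occ-end = countBelow-unique n (n ∸ 1) _ n∸1<n only (==ₗ-true⁺ refl)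
    where
    only : ∀ s → s < n → (node s ==ₗ node (n ∸ 1)) ≡ true → s ≡ n ∸ 1
    only s s< e with s ≟ (n ∸ 1)
    ... | yes eq = eq
    ... | no  ne = ⊥-elim (proj₂ endMarked s s+1<n
                     (trans (sym (sc-<n s s<)) (trans (node-head s (n ∸ 1) (==ₗ-true⁻ e)) (trans (sc-<n _ n∸1<n) (proj₁ endMarked)))))
      where
      s+1<n : suc s < n
      s+1<n = subst (suc s <_) suc[n∸1]≡n (s≤s (≤∧≢⇒< (≤-pred (subst (s <_) (sym suc[n∸1]≡n) s<)) ne))

  occ-≥2 : ∀ q → q < n → firstRow (nd q) ≢ q → 2 ≤ occ (nd q)
  occ-≥2 q q< notFirst with firstRow-spec (nd q) q q< refl
  ... | _ , f< , ndf = countBelow-two n (sa q) (sa (firstRow (nd q))) _ (sa< q q<) (sa< _ f<)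
                         (λ e → notFirst (sym (sa-injective _ _ q< f< e))) (==ₗ-true⁺ refl) (==ₗ-true⁺ ndf)

  LF-node : ∀ {u v} → IF u v → ∀ r → r < n → nd r ≡ v → nd (lf r) ≡ u
  LF-node f r r< e = trans (cong node (sa-lf r r<)) (F-prev f (prev (sa r)) (trans (node-suc-prev (sa r)) e))

  L-from-LF-nodes : ∀ r r' → r < n → r' < n → nd (lf r) ≡ nd (lf r') → Lc r ≡ Lc r'
  L-from-LF-nodes r r' r< r'< e =
    trans (L≡sc-prev r) (trans (cong sc (sym (sa-lf r r<)))
      (trans (node-head _ _ e) (trans (cong sc (sa-lf r' r'<)) (sym (L≡sc-prev r')))))

  LF-firstRow : ∀ {u v} → IF u v → ∀ r → r < n → nd r ≡ v → lf (firstRow v) ≡ firstRow u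
  LF-firstRow {u} {v} f r r< e = ≤-antisym upper lower
    where
    b : ℕ
    b = firstRow v
    b< : b < n
    b< = proj₁ (proj₂ (firstRow-spec v r r< e))
    ndb : nd b ≡ v
    ndb = proj₂ (proj₂ (firstRow-spec v r r< e))
    fu : firstRow u ≤ lf b × firstRow u < n × nd (firstRow u) ≡ u
    fu = firstRow-spec u (lf b) (lf< _ b<) (LF-node f _ b< ndb)
    lower : firstRow u ≤ lf b
    lower = proj₁ fu
    -- the rotation one position after that of firstRow u is prefixed by v and maps back to it
    x : ℕ
    x = sa (firstRow u)
    x< : x < n
    x< = sa< _ (proj₁ (proj₂ fu))
    r′ : ℕ
    r′ = pos (next x)
    r′< : r′ < n
    r′< = pos< _ (next< x)
    ndr′ : nd r′ ≡ v
    ndr′ = trans (cong node (sa-pos _ (next< x))) (trans (cyc-% (suc x) k) (F-next f x (proj₂ (proj₂ fu))))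
    lfr′ : lf r′ ≡ firstRow u
    lfr′ = trans (LF≡σ _ r′<) (trans (cong (pos ∘ prev) (sa-pos _ (next< x)))
             (trans (cong pos (prev-next _ x<)) (pos-sa _ (proj₁ (proj₂ fu)))))
    upper : lf b ≤ firstRow u
    upper = subst (lf b ≤_) lfr′
              (lf-mono-≤ _ _ (proj₁ (firstRow-spec v r′ r′< ndr′)) r′<
                (L-from-LF-nodes _ _ b< r′< (trans (LF-node f _ b< ndb) (sym (LF-node f _ r′< ndr′)))))

  module Chain (h : ℕ → List ℕ) (Y : ℕ) (chain : ∀ y → suc y < Y → IF (h (suc y)) (h y)) where

    iter-node : ∀ y r → y < Y → r < n → nd r ≡ h 0 → nd (iter y lf r) ≡ h y
    iter-node zero    r _  r< e = e
    iter-node (suc y) r y< r< e =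
      LF-node (chain y y<) _ (iter-lf< y r r<) (iter-node y r (<-trans (n<1+n y) y<) r< e)

    iter-firstRow : ∀ y r → y < Y → r < n → nd r ≡ h 0 → iter y lf (firstRow (h 0)) ≡ firstRow (h y)
    iter-firstRow zero    r _  r< e = refl
    iter-firstRow (suc y) r y< r< e =
      trans (cong lf (iter-firstRow y r (<-trans (n<1+n y) y<) r< e))
            (LF-firstRow (chain y y<) _ (iter-lf< y r r<) (iter-node y r (<-trans (n<1+n y) y<) r< e))

    iter-mono : ∀ y r₁ r₂ → y < Y → r₁ < r₂ → r₂ < n → nd r₁ ≡ h 0 → nd r₂ ≡ h 0 → iter y lf r₁ < iter y lf r₂
    iter-mono zero    r₁ r₂ _  lt r₂< e₁ e₂ = lt
    iter-mono (suc y) r₁ r₂ y< lt r₂< e₁ e₂ =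
      lf-mono _ _ (iter-mono y r₁ r₂ y' lt r₂< e₁ e₂) (iter-lf< y r₂ r₂<)
        (L-from-LF-nodes _ _ (iter-lf< y r₁ r₁<) (iter-lf< y r₂ r₂<)
          (trans (LF-node (chain y y<) _ (iter-lf< y r₁ r₁<) (iter-node y r₁ y' r₁< e₁))
                 (sym (LF-node (chain y y<) _ (iter-lf< y r₂ r₂<) (iter-node y r₂ y' r₂< e₂)))))
      where
      y' : y < Y
      y' = <-trans (n<1+n y) y<
      r₁< : r₁ < n
      r₁< = <-trans lt r₂<

  -- a unary path, read backwards from its last node, is such a chain
  module PathChain (p : List (List ℕ)) (p≢[] : p ≢ []) (linked : Linked IF p) where
    W : ℕ
    W = length p

    W≥1 : 1 ≤ W
    W≥1 = length≥1 p p≢[]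

    h : ℕ → List ℕ
    h y = nth p (W ∸ 1 ∸ y)

    h0 : h 0 ≡ lastNode p
    h0 = sym (lastNode≡nth p p≢[])

    chain : ∀ y → suc y < W → IF (h (suc y)) (h y)
    chain y lt = subst (IF (h (suc y))) (cong (nth p) (suc[m∸suc-n]≡m∸n (W ∸ 1) y sy≤))
                   (Linked-nth p linked (W ∸ 1 ∸ suc y) lt')
      where
      sy≤ : suc y ≤ W ∸ 1
      sy≤ = ≤-pred (subst (suc (suc y) ≤_) (sym (m+[n∸m]≡n W≥1)) lt)
      lt' : suc (W ∸ 1 ∸ suc y) < W
      lt' = subst (_< W) (sym (suc[m∸suc-n]≡m∸n (W ∸ 1) y sy≤))
              (≤-<-trans (m∸n≤m (W ∸ 1) y) (subst (W ∸ 1 <_) (m+[n∸m]≡n W≥1) ≤-refl))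

    open Chain h W chain public

  -- (2) The rows marked in L and D_out are exactly the redundant rows

  marksOut : List (List ℕ) → ℕ → Bool
  marksOut p q = let v = lastNode p in
    anyBelow (lastRow v ∸ firstRow v) (λ d → anyBelow (length p ∸ 1) (λ x → iter x lf (suc (firstRow v) + d) ≡ᵇ q))

  markedOut≡any : ∀ P q → markedOut S sa (map (prefixInterval S sa k) P) q ≡ any (λ p → marksOut p q) P
  markedOut≡any P q = any-map _ (prefixInterval S sa k) P

  redundant : ℕ → Bool
  redundant q = F-at (prev (sa q)) ∧ not (firstRow (nd q) ≡ᵇ q)

  -- q = LF^x (y) for a row y inside the interval of the path's last node, so q is prefixed by
  -- the x-th node from the end, entered by an F-edge, and LF^x (firstRow) < LF^x (y) = q
  marks⇒redundant : ∀ q → q < n → ∀ p → IsLongestUnaryPath S k p → marksOut p q ≡ true → redundant q ≡ true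
  marks⇒redundant q q< p ((p≢[] , _ , _ , linked) , _ , _) marked with anyBelow-true⁻ _ _ marked
  ... | d , d< , marked' with anyBelow-true⁻ _ _ marked'
  ... | x , x< , hit with inner-row (lastNode p) d d<
  ... | _ , ndi , y< , ndy = ∧-true⁺ enteredByF (not-true⁺ (≡ᵇ-false⁺ (<⇒≢ firstRow<q)))
    where
    open PathChain p p≢[] linked
    i : ℕ
    i = firstRow (lastNode p)
    y : ℕ
    y = suc i + d
    q≡ : iter x lf y ≡ q
    q≡ = ≡ᵇ-true⁻ hit
    x<W : x < W
    x<W = <-≤-trans x< (m∸n≤m W 1)
    ndy' : nd y ≡ h 0
    ndy' = trans ndy (sym h0)
    ndq : nd q ≡ h x
    ndq = subst (λ z → nd z ≡ h x) q≡ (iter-node x y x<W y< ndy')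
    firstRow<q : firstRow (nd q) < q
    firstRow<q = subst₂ _<_ (trans (cong (iter x lf ∘ firstRow) (sym h0)) (trans (iter-firstRow x y x<W y< ndy') (cong firstRow (sym ndq)))) q≡
                   (iter-mono x i y x<W (s≤s (m≤m+n i d)) y< (trans ndi (sym h0)) ndy')
    entering : IF (h (suc x)) (h x)
    entering = chain x (subst (suc (suc x) ≤_) (m+[n∸m]≡n W≥1) (s≤s x<))
    node-after : node (suc (prev (sa q))) ≡ h x
    node-after = trans (node-suc-prev (sa q)) ndq
    enteredByF : F-at (prev (sa q)) ≡ true
    enteredByF = F-at⁺ (prev (sa q)) (subst₂ IF (sym (F-prev entering (prev (sa q)) node-after)) (sym node-after) entering)

  -- Conversely, a redundant row q lies on the longest unary path through its node, built by
  -- walking from t = sa q forwards and backwards along F-edges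
  module LongestPathThrough (q : ℕ) (q< : q < n) (enteredByF : F-at (prev (sa q)) ≡ true) (notFirst : firstRow (nd q) ≢ q) where
    t : ℕ
    t = sa q
    t< : t < n
    t< = sa< q q<
    v : List ℕ
    v = nd q

    -- a walk along F-edges keeps the number of occurrences, which is ≥ 2 for v but 1 at $
    not-end : ∀ s → node s ≡ node (n ∸ 1) → occ (node s) ≡ occ v → ⊥
    not-end s e same = 2≰1 (subst (2 ≤_) (trans (sym same) (trans (cong occ e) occ-end)) (occ-≥2 q q< notFirst))
      where
      2≰1 : ¬ (2 ≤ 1)
      2≰1 (s≤s ())

    occ-forward : ∀ e → (∀ e' → e' < e → F-at (t + e') ≡ true) → occ (node (t + e)) ≡ occ v
    occ-forward zero    _  = cong (occ ∘ node) (+-identityʳ t)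
    occ-forward (suc e) inF = trans (cong (occ ∘ node) (+-suc t e))
      (trans (sym (occ-F (F-at⁻ (t + e) (inF e ≤-refl)))) (occ-forward e (λ e' lt → inF e' (<-trans lt (n<1+n e)))))

    stopsForward : ℕ → Bool
    stopsForward e = not (F-at (t + e))

    forward-stops : ∃[ e ] (e < n × stopsForward e ≡ true)
    forward-stops with anyBelow n stopsForward in found
    ... | true  = anyBelow-true⁻ n stopsForward found
    ... | false = ⊥-elim (not-end (t + e*) (cong node t+e*≡)
                    (occ-forward e* (λ e' lt → not-false⁻ (anyBelow-false⁻ n _ found e' (<-≤-trans lt e*≤n)))))
      where
      e* : ℕ
      e* = n ∸ 1 ∸ t
      t+e*≡ : t + e* ≡ n ∸ 1
      t+e*≡ = m+[n∸m]≡n (≤-pred (subst (suc t ≤_) (sym suc[n∸1]≡n) t<))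
      e*≤n : e* ≤ n
      e*≤n = ≤-trans (m∸n≤m (n ∸ 1) t) (m∸n≤m n 1)

    E : ℕ
    E = firstBelow n stopsForward
    E-stop : F-at (t + E) ≡ false
    E-stop = not-true⁻ (proj₂ (firstBelow-witness n stopsForward forward-stops))
    E-before : ∀ e → e < E → F-at (t + e) ≡ true
    E-before e lt = not-false⁻ (firstBelow-minimal n stopsForward e lt)

    -- the backward walk starts from N = t + n ≡ t (mod n)
    N : ℕ
    N = t + n
    n≤N : n ≤ N
    n≤N = m≤n+m n t

    occ-backward : ∀ b → b ≤ N → (∀ b' → b' < b → F-at (N ∸ suc b') ≡ true) → occ (node (N ∸ b)) ≡ occ v
    occ-backward zero    _  _  = cong occ (cyc-+n t k)
    occ-backward (suc b) le inF = trans (occ-F (F-at⁻ (N ∸ suc b) (inF b ≤-refl)))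
      (trans (cong (occ ∘ node) (suc[m∸suc-n]≡m∸n N b le))
             (occ-backward b (≤-trans (n≤1+n b) le) (λ b' lt → inF b' (<-trans lt (n<1+n b)))))

    stopsBackward : ℕ → Bool
    stopsBackward b = not (F-at (N ∸ suc b))

    backward-stops : ∃[ b ] (b < n × stopsBackward b ≡ true)
    backward-stops with anyBelow n stopsBackward in found
    ... | true  = anyBelow-true⁻ n stopsBackward found
    ... | false = ⊥-elim (not-end (N ∸ suc t) (cong node N∸suc-t≡) (occ-backward (suc t) (≤-trans t< n≤N)
                    (λ b' lt → not-false⁻ (anyBelow-false⁻ n _ found b' (<-≤-trans lt t<)))))
      where
      N∸suc-t≡ : N ∸ suc t ≡ n ∸ 1
      N∸suc-t≡ = trans (cong (N ∸_) (+-comm 1 t)) (trans (sym (∸-+-assoc N t 1)) (cong (_∸ 1) (m+n∸m≡n t n)))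

    B : ℕ
    B = firstBelow n stopsBackward
    B< : B < n
    B< = proj₁ (firstBelow-witness n stopsBackward backward-stops)
    B-stop : F-at (N ∸ suc B) ≡ false
    B-stop = not-true⁻ (proj₂ (firstBelow-witness n stopsBackward backward-stops))
    B-before : ∀ b → b < B → F-at (N ∸ suc b) ≡ true
    B-before b lt = not-false⁻ (firstBelow-minimal n stopsBackward b lt)

    -- q is entered by an F-edge, so the backward walk makes at least one step
    B≥1 : 1 ≤ B
    B≥1 with B in B≡
    ... | suc _ = s≤s z≤n
    ... | zero  = ⊥-elim (true≢false (trans (sym enteredByF)
                    (trans (F-at-% (t + (n ∸ 1))) (trans (cong F-at (sym (+-∸-assoc t n≥1)))
                      (subst (λ z → F-at (N ∸ suc z) ≡ false) B≡ B-stop)))))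

    B≤N : B ≤ N
    B≤N = ≤-trans (<⇒≤ B<) n≤N

    -- the path: the nodes at positions a, a + 1, …, a + B + E, where a ≡ t − B (mod n)
    a : ℕ
    a = N ∸ B
    a+B≡N : a + B ≡ N
    a+B≡N = m∸n+n≡m B≤N

    W : ℕ
    W = suc (B + E)

    f : ℕ → List ℕ
    f s = node (a + s)

    p : List (List ℕ)
    p = applyUpTo f W

    a+[B+e] : ∀ e → a + (B + e) ≡ t + e + n
    a+[B+e] e = trans (sym (+-assoc a B e)) (trans (cong (_+ e) a+B≡N)
                  (trans (+-assoc t n e) (trans (cong (t +_) (+-comm n e)) (sym (+-assoc t e n)))))

    F-along : ∀ s → suc s < W → F-at (a + s) ≡ true
    F-along s lt with s <? B
    ... | yes s<B = subst (λ z → F-at z ≡ true) (m∸suc[b∸suc-s]≡m∸b+s N B s s<B B≤N) (B-before (B ∸ suc s) back<B)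
      where
      back<B : B ∸ suc s < B
      back<B = subst (_≤ B) (sym (suc[m∸suc-n]≡m∸n B s s<B)) (m∸n≤m B s)
    ... | no  s≮B = trans (cong F-at (trans (cong (a +_) (sym B+e≡s)) (a+[B+e] e))) (trans (F-at-+n (t + e)) (E-before e e<E))
      where
      e : ℕ
      e = s ∸ B
      B+e≡s : B + e ≡ s
      B+e≡s = m+[n∸m]≡n (≮⇒≥ s≮B)
      e<E : e < E
      e<E = +-cancelˡ-< B e E (subst (_< B + E) (sym B+e≡s) (≤-pred lt))

    F-after : F-at (a + (B + E)) ≡ false
    F-after = trans (cong F-at (a+[B+e] E)) (trans (F-at-+n (t + E)) E-stop)

    a≥1 : 1 ≤ a
    a≥1 = m<n⇒0<n∸m (<-≤-trans B< n≤N)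

    F-before : F-at (a ∸ 1) ≡ false
    F-before = trans (cong F-at (trans (∸-+-assoc N B 1) (cong (N ∸_) (+-comm B 1)))) B-stop

    f-suc : ∀ s → f (suc s) ≡ node (suc (a + s))
    f-suc s = cong node (+-suc a s)

    linked : Linked IF p
    linked = Linked-applyUpTo W f (λ s lt → subst (IF (f s)) (sym (f-suc s)) (F-at⁻ (a + s) (F-along s lt)))

    -- a repeated node would force an F-edge out of the last node
    distinct : ∀ d s s' → s < s' → s' + d ≡ B + E → f s ≢ f s'
    distinct zero    s s' lt last same =
      true≢false (trans (sym (F-along s s+1<W)) (trans (F-at-node _ _ same) (trans (cong (F-at ∘ (a +_)) s'≡) F-after)))
      where
      s'≡ : s' ≡ B + E
      s'≡ = trans (sym (+-identityʳ s')) last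
      s+1<W : suc s < W
      s+1<W = s≤s (subst (suc s ≤_) s'≡ lt)
    distinct (suc d) s s' lt last same = distinct d (suc s) (suc s') (s≤s lt) (trans (sym (+-suc s' d)) last) same'
      where
      s'+1<W : suc s' < W
      s'+1<W = s≤s (subst (suc s' ≤_) last (subst (_≤ s' + suc d) (+-comm s' 1) (+-monoʳ-≤ s' (s≤s z≤n))))
      step : IF (f s) (node (suc (a + s)))
      step = F-at⁻ (a + s) (F-along s (<-trans (s≤s lt) s'+1<W))
      same' : f (suc s) ≡ f (suc s')
      same' = trans (f-suc s) (trans (sym (F-next step (a + s') (sym same))) (sym (f-suc s')))

    p≢[] : p ≢ []
    p≢[] ()

    lastNode-p : lastNode p ≡ f (B + E)
    lastNode-p = trans (lastNode≡nth p p≢[])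
                   (trans (cong (λ z → nth p (z ∸ 1)) (length-applyUpTo f W)) (nth-applyUpTo W f (B + E) ≤-refl))

    longest : IsLongestUnaryPath S k p
    longest = (p≢[] , nodes , unique , linked) , noExtensionLeft , noExtensionRight
      where
      nodes : All (IsNode S k) p
      nodes = applyUpTo⁺₁ f W (λ {s} _ → (a + s) % n , m%n<n _ n , cyc-% (a + s) k)
      unique : Unique p
      unique = Unique-applyUpTo W f (λ s s' lt lt' → distinct (B + E ∸ s') s s' lt (m+[n∸m]≡n (≤-pred lt')))
      noExtensionLeft : ∀ z → ¬ IsUnaryPath S k (z ∷ p)
      noExtensionLeft z (_ , _ , _ , (link ∷ _)) =
        true≢false (trans (sym (F-at⁺ (a ∸ 1) (subst₂ IF (sym before) (sym first) link))) F-before)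
        where
        first : node (suc (a ∸ 1)) ≡ f 0
        first = cong node (trans (m+[n∸m]≡n a≥1) (sym (+-identityʳ a)))
        before : node (a ∸ 1) ≡ z
        before = F-prev link (a ∸ 1) first
      noExtensionRight : ∀ z → ¬ IsUnaryPath S k (p ∷ʳ z)
      noExtensionRight z (_ , _ , _ , l) =
        true≢false (trans (sym (F-at⁺ (a + (B + E)) (subst₂ IF lastNode-p (sym after) link))) F-after)
        where
        link : IF (lastNode p) z
        link = Linked-∷ʳ p z l p≢[]
        after : node (suc (a + (B + E))) ≡ z
        after = F-next link (a + (B + E)) (sym lastNode-p)

    -- the row r₀ of the rotation at the forward end t + E is prefixed by the last node of p,
    -- and E steps of LF lead from it to q
    module PC = PathChain p p≢[] linked

    x₀ : ℕ
    x₀ = (t + E) % n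
    x₀< : x₀ < n
    x₀< = m%n<n (t + E) n
    r₀ : ℕ
    r₀ = pos x₀
    r₀< : r₀ < n
    r₀< = pos< x₀ x₀<

    lastNode-p≡ : lastNode p ≡ node (t + E)
    lastNode-p≡ = trans lastNode-p (trans (cong node (a+[B+e] E)) (cyc-+n (t + E) k))

    nd-r₀ : nd r₀ ≡ lastNode p
    nd-r₀ = trans (cong node (sa-pos x₀ x₀<)) (trans (cyc-% (t + E) k) (sym lastNode-p≡))

    iter-r₀ : iter E lf r₀ ≡ q
    iter-r₀ = sa-injective _ q (iter-lf< E r₀ r₀<) q<
      (trans (sa-iter-lf E r₀ r₀<) (trans (cong (iter E prev) (sa-pos x₀ x₀<)) (trans (iter-prev E t) (m<n⇒m%n≡m t<))))
      where
      iter-prev : ∀ e y → iter e prev ((y + e) % n) ≡ y % n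
      iter-prev zero    y = cong (_% n) (+-identityʳ y)
      iter-prev (suc e) y = trans (cong (λ z → prev (iter e prev (z % n))) (+-suc y e))
                              (trans (cong prev (iter-prev e (suc y))) (prev-next-% y))

    E<length : E < length p
    E<length = subst (E <_) (sym (length-applyUpTo f W)) (s≤s (m≤n+m E B))

    h-E : PC.h E ≡ v
    h-E = trans (cong (nth p) (trans (cong (λ z → z ∸ 1 ∸ E) (length-applyUpTo f W)) (m+n∸n≡m B E)))
            (trans (nth-applyUpTo W f B (s≤s (m≤m+n B E))) (trans (cong node a+B≡N) (cyc-+n t k)))

    -- r₀ is not the first row of its block: that one is mapped to firstRow v ≠ q
    firstRow<r₀ : firstRow (lastNode p) < r₀
    firstRow<r₀ = ≤∧≢⇒< (proj₁ (firstRow-spec _ r₀ r₀< nd-r₀))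
                    (λ e → notFirst (trans (sym maps-first) (trans (cong (iter E lf) e) iter-r₀)))
      where
      maps-first : iter E lf (firstRow (lastNode p)) ≡ firstRow v
      maps-first = trans (cong (iter E lf ∘ firstRow) (sym PC.h0))
                     (trans (PC.iter-firstRow E r₀ E<length r₀< (trans nd-r₀ (sym PC.h0))) (cong firstRow h-E))

    marks : marksOut p q ≡ true
    marks = anyBelow-true⁺ (j ∸ i) _ d d<
              (anyBelow-true⁺ (length p ∸ 1) _ E E<w (≡ᵇ-true⁺ (trans (cong (iter E lf) i+1+d≡r₀) iter-r₀)))
      where
      i : ℕ
      i = firstRow (lastNode p)
      j : ℕ
      j = lastRow (lastNode p)
      d : ℕ
      d = r₀ ∸ suc i
      i+1+d≡r₀ : suc i + d ≡ r₀
      i+1+d≡r₀ = m+[n∸m]≡n firstRow<r₀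
      r₀≤j : r₀ ≤ j
      r₀≤j = proj₁ (lastBelow-spec n _ r₀ r₀< (==ₗ-true⁺ nd-r₀))
      d< : d < j ∸ i
      d< = subst (_≤ j ∸ i) (m+n∸m≡n i (suc d)) (∸-monoˡ-≤ i (subst (_≤ j) (trans (sym i+1+d≡r₀) (sym (+-suc i d))) r₀≤j))
      E<w : E < length p ∸ 1
      E<w = subst (λ z → E < z ∸ 1) (sym (length-applyUpTo f W)) (+-monoˡ-≤ E B≥1)

  redundant⇒marks : ∀ q → q < n → redundant q ≡ true → ∃[ p ] (IsLongestUnaryPath S k p × marksOut p q ≡ true)
  redundant⇒marks q q< r with ∧-true⁻ {F-at (prev (sa q))} r
  ... | enteredByF , notFirst = p , longest , marks
    where open LongestPathThrough q q< enteredByF (λ eq → true≢false (trans (sym (≡ᵇ-true⁺ eq)) (not-true⁻ notFirst)))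

  -- (3) Counting the redundant rows edge by edge

  D : List (List ℕ)
  D = edgeKmers S k

  D-unique : Unique D
  D-unique = UniqueDec.deduplicate-! (≡-dec _≟_) (map kmer (upTo n))

  D⁻ : ∀ z → z ∈ D → ∃[ s ] (s < n × kmer s ≡ z)
  D⁻ z z∈ with ∈-map⁻ kmer (∈-deduplicate⁻ (≡-dec _≟_) (map kmer (upTo n)) z∈)
  ... | s , s∈ , e = s , ∈-upTo⁻ s∈ , sym e

  D⁺ : ∀ s → s < n → kmer s ∈ D
  D⁺ s s< = ∈-deduplicate⁺ (≡-dec _≟_) (∈-map⁺ kmer (∈-upTo⁺ s<))

  entering : ℕ → List ℕ
  entering t = kmer (prev t)

  redundantAt : ℕ → Bool
  redundantAt t = F-at (prev t) ∧ not (firstRow (node t) ≡ᵇ pos t)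

  entering-mult : ∀ z → countBelow n (λ t → entering t ==ₗ z) ≡ mult S k z
  entering-mult z = countBelow-permute n prev (λ i → kmer i ==ₗ z) (λ t _ → prev< t) prev-injective

  mult≥1 : ∀ z → z ∈ D → 1 ≤ mult S k z
  mult≥1 z z∈ with D⁻ z z∈
  ... | s , s< , e rewrite countBelow-remove n s (λ i → kmer i ==ₗ z) s< | ==ₗ-true⁺ e = m≤n+m 1 _

  redundantEntered : List ℕ → ℕ
  redundantEntered z = countBelow n (λ t → (entering t ==ₗ z) ∧ redundantAt t)

  redundant-nonF : ∀ z → inFᵇ S k z ≡ false → redundantEntered z ≡ 0
  redundant-nonF z notF = countBelow-none n (λ t _ → none t)
    where
    none : ∀ t → ((entering t ==ₗ z) ∧ redundantAt t) ≡ false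
    none t with entering t ==ₗ z in e
    ... | false = refl
    ... | true rewrite cong (inFᵇ S k) (==ₗ-true⁻ e) | notF = refl

  -- an F-edge (u , v) of multiplicity m enters the m rows of v's block, all but the first redundant
  redundant-F : ∀ z → z ∈ D → inFᵇ S k z ≡ true → redundantEntered z ≡ mult S k z ∸ 1
  redundant-F z z∈ inF with D⁻ z z∈
  ... | s₀ , s₀< , kmer-s₀ =
    trans (countBelow-cong n (λ t _ → drop-F t)) (trans (sym (m+n∸m≡n 1 _)) (cong (_∸ 1) (trans (sym split) (entering-mult z))))
    where
    v : List ℕ
    v = drop 1 z
    edge : IF (node s₀) (node (suc s₀))
    edge = F-at⁻ s₀ (trans (cong (inFᵇ S k) kmer-s₀) inF)
    v≡ : v ≡ node (suc s₀)
    v≡ = trans (cong (drop 1) (sym kmer-s₀)) (drop-kmer s₀)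
    u≡ : take k z ≡ node s₀
    u≡ = trans (cong (take k) (sym kmer-s₀)) (take-kmer s₀)
    x₁ : ℕ
    x₁ = suc s₀ % n
    x₁< : x₁ < n
    x₁< = m%n<n (suc s₀) n
    b : ℕ
    b = firstRow v
    b-spec : firstRow v ≤ pos x₁ × b < n × nd b ≡ v
    b-spec = firstRow-spec v (pos x₁) (pos< x₁ x₁<) (trans (cong node (sa-pos x₁ x₁<)) (trans (cyc-% (suc s₀) k) (sym v≡)))
    b< : b < n
    b< = proj₁ (proj₂ b-spec)
    t* : ℕ
    t* = sa b
    isFirst : ℕ → Bool
    isFirst t = firstRow (node t) ≡ᵇ pos t
    drop-F : ∀ t → ((entering t ==ₗ z) ∧ redundantAt t) ≡ ((entering t ==ₗ z) ∧ not (isFirst t))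
    drop-F t with entering t ==ₗ z in e
    ... | false = refl
    ... | true rewrite cong (inFᵇ S k) (==ₗ-true⁻ e) | inF = refl
    node-entered : ∀ t → entering t ≡ z → node t ≡ v
    node-entered t e = trans (sym (node-suc-prev t)) (trans (sym (drop-kmer (prev t))) (cong (drop 1) e))
    only-t* : ∀ t → t < n → ((entering t ==ₗ z) ∧ isFirst t) ≡ true → t ≡ t*
    only-t* t t< e with ∧-true⁻ {entering t ==ₗ z} e
    ... | enters , first =
      trans (sym (sa-pos t t<)) (cong sa (sym (trans (cong firstRow (sym (node-entered t (==ₗ-true⁻ enters)))) (≡ᵇ-true⁻ first))))
    t*-entered : entering t* ≡ z
    t*-entered = take-drop-injective k k≥1 _ _
      (trans (take-kmer (prev t*)) (trans (F-prev edge (prev t*) (trans (node-suc-prev t*) (trans (proj₂ (proj₂ b-spec)) v≡))) (sym u≡)))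
      (trans (drop-kmer (prev t*)) (trans (node-suc-prev t*) (proj₂ (proj₂ b-spec))))
    t*-first : isFirst t* ≡ true
    t*-first = ≡ᵇ-true⁺ (trans (cong firstRow (proj₂ (proj₂ b-spec))) (sym (pos-sa b b<)))
    split : countBelow n (λ t → entering t ==ₗ z) ≡ 1 + countBelow n (λ t → (entering t ==ₗ z) ∧ not (isFirst t))
    split = trans (countBelow-split n (λ t → entering t ==ₗ z) isFirst)
              (cong (_+ countBelow n (λ t → (entering t ==ₗ z) ∧ not (isFirst t)))
                (countBelow-unique n t* _ (sa< b b<) only-t* (∧-true⁺ (==ₗ-true⁺ t*-entered) t*-first)))

  redundant-per-edge : ∀ z → z ∈ D → redundantEntered z ≡ (if inFᵇ S k z then mult S k z ∸ 1 else 0)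
  redundant-per-edge z z∈ with inFᵇ S k z in inF
  ... | true  = redundant-F z z∈ inF
  ... | false = redundant-nonF z inF

  -- every edge z contributes (its count in Ẽ) + (its redundant rows) = mult z rows
  redundant+reduced : countBelow n redundantAt + reducedEdgeCount S k ≡ n
  redundant+reduced = begin
      countBelow n redundantAt + reducedEdgeCount S k
        ≡⟨ cong (_+ reducedEdgeCount S k) (sym (countBelow-groupBy n D entering redundantAt D-unique (λ t _ → D⁺ (prev t) (prev< t)))) ⟩
      sum (map redundantEntered D) + reducedEdgeCount S k
        ≡⟨ cong (_+ reducedEdgeCount S k) (sum-cong D redundant-per-edge) ⟩
      sum (map (λ z → if inFᵇ S k z then mult S k z ∸ 1 else 0) D) + sum (map (λ z → if inFᵇ S k z then 1 else mult S k z) D)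
        ≡⟨ sym (sum-+ D _ _) ⟩
      sum (map (λ z → (if inFᵇ S k z then mult S k z ∸ 1 else 0) + (if inFᵇ S k z then 1 else mult S k z)) D)
        ≡⟨ sum-cong D (λ z z∈ → per-edge (inFᵇ S k z) (mult S k z) (mult≥1 z z∈)) ⟩
      sum (map (mult S k) D)
        ≡⟨ sum-cong D (λ z _ → trans (sym (entering-mult z)) (countBelow-cong n (λ t _ → sym (∧-identityʳ _)))) ⟩
      sum (map (λ z → countBelow n (λ t → (entering t ==ₗ z) ∧ true)) D)
        ≡⟨ countBelow-groupBy n D entering (λ _ → true) D-unique (λ t _ → D⁺ (prev t) (prev< t)) ⟩
      countBelow n (λ _ → true)
        ≡⟨ countBelow-all n (λ _ _ → refl) ⟩
      n ∎
    where
    open ≡-Reasoning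
    per-edge : ∀ b m → 1 ≤ m → (if b then m ∸ 1 else 0) + (if b then 1 else m) ≡ m
    per-edge true  m 1≤m = trans (+-comm (m ∸ 1) 1) (m+[n∸m]≡n 1≤m)
    per-edge false m _   = refl

  module Tunneled (P : List (List (List ℕ))) (sound : ∀ p → p ∈ P → IsLongestUnaryPath S k p)
                  (complete : ∀ p → IsLongestUnaryPath S k p → p ∈ P) where
    ivs : List (PrefixInterval S sa)
    ivs = map (prefixInterval S sa k) P

    markedOut≡redundant : ∀ q → q < n → markedOut S sa ivs q ≡ redundant q
    markedOut≡redundant q q< = trans (markedOut≡any P q) (Bool-≡ to from)
      where
      to : any (λ p → marksOut p q) P ≡ true → redundant q ≡ true
      to e with any-true⁻ _ P e
      ... | p , p∈ , marked = marks⇒redundant q q< p (sound p p∈) marked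
      from : redundant q ≡ true → any (λ p → marksOut p q) P ≡ true
      from r = listed (redundant⇒marks q q< r)
        where
        listed : ∃[ p ] (IsLongestUnaryPath S k p × marksOut p q ≡ true) → any (λ p → marksOut p q) P ≡ true
        listed (p , longest , marked) = any-true⁺ (λ p → marksOut p q) (complete p longest) marked

    markedOut+reduced : countBelow n (markedOut S sa ivs) + reducedEdgeCount S k ≡ n
    markedOut+reduced = trans (cong (_+ reducedEdgeCount S k) markedOut≡redundantAt) redundant+reduced
      where
      markedOut≡redundantAt : countBelow n (markedOut S sa ivs) ≡ countBelow n redundantAt
      markedOut≡redundantAt = trans (countBelow-cong n markedOut≡redundant)
        (trans (sym (countBelow-permute n pos redundant pos< pos-injective))
               (countBelow-cong n (λ t t< → cong (λ z → F-at (prev z) ∧ not (firstRow (node z) ≡ᵇ pos t)) (sa-pos t t<))))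

    markedIn-lf : ∀ q → q < n → markedIn S sa ivs (lf q) ≡ markedOut S sa ivs q
    markedIn-lf q q< = trans (any-map _ (prefixInterval S sa k) P) (trans (any-cong P (λ p _ → same p)) (sym (markedOut≡any P q)))
      where
      same : ∀ p → let v = lastNode p in
        anyBelow (lastRow v ∸ firstRow v) (λ d → anyBelow (length p ∸ 1) (λ x → lf (iter x lf (suc (firstRow v) + d)) ≡ᵇ lf q))
        ≡ marksOut p q
      same p = anyBelow-cong (lastRow v ∸ firstRow v) (λ d d< → anyBelow-cong (length p ∸ 1) (λ x _ →
                 let y< = iter-lf< x _ (proj₁ (proj₂ (proj₂ (inner-row v d d<)))) in
                 Bool-≡ (λ e → ≡ᵇ-true⁺ (lf-injective _ q y< q< (≡ᵇ-true⁻ e))) (λ e → ≡ᵇ-true⁺ (cong lf (≡ᵇ-true⁻ e)))))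
        where
          v : List ℕ
          v = lastNode p

    markedIn≡markedOut : countBelow n (markedIn S sa ivs) ≡ countBelow n (markedOut S sa ivs)
    markedIn≡markedOut = trans (sym (countBelow-permute n lf (markedIn S sa ivs) lf< lf-injective)) (countBelow-cong n markedIn-lf)

    length-kept : ∀ (marked : ℕ → Bool) → countBelow n marked ≡ countBelow n (markedOut S sa ivs) →
      length (filterᵇ (not ∘ marked) (upTo n)) ≡ reducedEdgeCount S k
    length-kept marked same = +-cancelʳ-≡ _ _ _
      (trans (cong (length (filterᵇ (not ∘ marked) (upTo n)) +_) (sym same))
        (trans (length-filter-not n marked) (sym (trans (+-comm (reducedEdgeCount S k) _) markedOut+reduced))))

corollary1 : (S : List ℕ) {{nz : NonZero (length S)}} → IsEndMarked S →
    (k : ℕ) → 1 ≤ k → k ≤ length S →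
    (sa : ℕ → ℕ) → IsSortedRotations S sa →
    (P : List (List (List ℕ))) → Unique P →
    (∀ p → p ∈ P → IsLongestUnaryPath S k p) →
    (∀ p → IsLongestUnaryPath S k p → p ∈ P) →
    length (tunneledL S sa (map (prefixInterval S sa k) P)) ≡ reducedEdgeCount S k
      × length (tunneledDout S sa (map (prefixInterval S sa k) P)) ≡ reducedEdgeCount S k
      × length (tunneledDin S sa (map (prefixInterval S sa k) P)) ≡ reducedEdgeCount S k
corollary1 S endMarked k k≥1 _ sa sorted P _ sound complete =
    trans (length-map (L S sa) keptOut) (length-kept (markedOut S sa ivs) refl)
  , trans (length-map (Dout₁ S sa ivs) keptOut) (length-kept (markedOut S sa ivs) refl)
  , trans (length-map (Din₁ S sa ivs) keptIn) (length-kept (markedIn S sa ivs) markedIn≡markedOut)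
  where
  open Tunneling S endMarked k k≥1 sa sorted
  open Tunneled P sound complete
  keptOut : List ℕ
  keptOut = filterᵇ (not ∘ markedOut S sa ivs) (upTo n)
  keptIn : List ℕ
  keptIn = filterᵇ (not ∘ markedIn S sa ivs) (upTo n)
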